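{- Let $a\geqslant 3$ be an integer and let $\beta>1$ satisfy $\beta^2=a\beta-1$. Every alphabet of contiguous integers containing $0$ with exactly $a$ elements allows parallel addition in base $\beta$, and no alphabet of contiguous integers containing $0$ and at least one other element, with fewer than $a$ elements, allows parallel addition in base $\beta$.
   Context: For a complex number $\beta$ with $|\beta|>1$ and a finite set $\mathcal{A}\subset\mathbb{C}$ containing $0$, let $\mathrm{Fin}_{\mathcal{A}}(\beta)=\{\sum_{j\in I}x_j\beta^j : I\subset\mathbb{Z}\text{ finite},\ x_j\in\mathcal{A}\}$. For finite alphabets $\mathcal{A},\mathcal{B}$, a map $\varphi:\mathcal{A}^{\mathbb{Z}}\to\mathcal{B}^{\mathbb{Z}}$ is $p$-local if there are integers $r,t\geqslant 0$ with $p=r+t+1$ and a map $\Phi:\mathcal{A}^p\to\mathcal{B}$ such that for every $u=(u_j)$ and $v=\varphi(u)$ one has $v_j=\Phi(u_{j+t}\cdots u_j\cdots u_{j-r})$ for all $j\in\mathbb{Z}$. A digit set conversion in base $\beta$ from $\mathcal{A}$ to $\mathcal{B}$ (both containing $0$) is a map $\varphi:\mathcal{A}^{\mathbb{Z}}\to\mathcal{B}^{\mathbb{Z}}$ such that whenever $u$ has finitely many nonzero entries, $v=\varphi(u)$ has finitely many nonzero entries and $\sum_j v_j\beta^j=\sum_j u_j\beta^j$. An alphabet $\mathcal{A}$ allows parallel addition in base $\beta$ if there is a digit set conversion in base $\beta$ from $\mathcal{A}+\mathcal{A}=\{x+y:x,y\in\mathcal{A}\}$ to $\mathcal{A}$ that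 is $p$-local for some $p$. -}

module Defs where

open import Data.Nat using (ℕ; zero; suc)
open import Data.Integer using (ℤ; +_; -[1+_]; _+_; _*_; _-_; -_; _≤_; _<_; ∣_∣)
import Data.Nat as N
open import Data.Fin using (Fin; toℕ)
open import Data.Product using (Σ; ∃; _×_; _,_)
open import Relation.Binary.PropositionalEquality using (_≡_)

-- An element (x , y) represents x + y·β.  Since a ≥ 3, β is a
-- quadratic irrational with minimal polynomial X² − aX + 1, so
-- ℤ[β] ≅ ℤ[X]/(X² − aX + 1) and equality of numbers x + yβ is
-- equality of the pairs.  β is a unit: β⁻¹ = a − β.

ZB : Set
ZB = ℤ × ℤ

module _ (a : ℕ) where

  zbZero : ZB
  zbZero = (+ 0 , + 0)

  zbOne : ZB
  zbOne = (+ 1 , + 0)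

  zbAdd : ZB → ZB → ZB
  zbAdd (x₁ , y₁) (x₂ , y₂) = (x₁ + x₂ , y₁ + y₂)

  -- (x₁ + y₁β)(x₂ + y₂β) using β² = aβ − 1
  zbMul : ZB → ZB → ZB
  zbMul (x₁ , y₁) (x₂ , y₂) =
    (x₁ * x₂ - y₁ * y₂ , x₁ * y₂ + y₁ * x₂ + (+ a) * (y₁ * y₂))

  zbInt : ℤ → ZB
  zbInt d = (d , + 0)

  zbβ : ZB
  zbβ = (+ 0 , + 1)

  zbβinv : ZB
  zbβinv = (+ a , - (+ 1))

  zbPowℕ : ZB → ℕ → ZB
  zbPowℕ b zero = zbOne
  zbPowℕ b (suc n) = zbMul b (zbPowℕ b n)

  βpow : ℤ → ZB
  βpow (+ n) = zbPowℕ zbβ n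
  βpow -[1+ n ] = zbPowℕ zbβinv (suc n)

  value : ℕ → (ℤ → ℤ) → ZB
  value zero u = zbMul (zbInt (u (+ 0))) (βpow (+ 0))
  value (suc n) u =
    zbAdd (value n u)
      (zbAdd (zbMul (zbInt (u (+ suc n))) (βpow (+ suc n)))
             (zbMul (zbInt (u -[1+ n ])) (βpow -[1+ n ])))

  SameValue : (ℤ → ℤ) → (ℤ → ℤ) → Set
  SameValue u v = ∃ λ (n : ℕ) →
    (∀ j → n N.< ∣ j ∣ → u j ≡ + 0) ×
    (∀ j → n N.< ∣ j ∣ → v j ≡ + 0) ×
    value n u ≡ value n v

Alphabet : Set₁
Alphabet = ℤ → Set

Contig : ℤ → ℤ → Alphabet
Contig m M x = (m ≤ x) × (x ≤ M)

SumAlph : Alphabet → Alphabet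
SumAlph A z = ∃ λ x → ∃ λ y → A x × A y × (z ≡ x + y)

FiniteSupport : (ℤ → ℤ) → Set
FiniteSupport u = ∃ λ (n : ℕ) → ∀ j → n N.< ∣ j ∣ → u j ≡ + 0

-- The p-local map with p = r + t + 1 induced by Φ :
--   φ(u)_j = Φ(u_{j+t} ⋯ u_j ⋯ u_{j−r})
-- (window position i ∈ Fin p holds u_{j+t−i}).
localMap : (r t : ℕ) → ((Fin (suc (r N.+ t)) → ℤ) → ℤ) → (ℤ → ℤ) → (ℤ → ℤ)
localMap r t Φ u j = Φ (λ i → u (j + (+ t) - (+ toℕ i)))

AllowsParallelAddition : ℕ → Alphabet → Set
AllowsParallelAddition a A =
  Σ ℕ λ r → Σ ℕ λ t → Σ ((Fin (suc (r N.+ t)) → ℤ) → ℤ) λ Φ →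
    ((w : Fin (suc (r N.+ t)) → ℤ) → (∀ i → SumAlph A (w i)) → A (Φ w)) ×
    ((u : ℤ → ℤ) → (∀ j → SumAlph A (u j)) → FiniteSupport u →
       SameValue a u (localMap r t Φ u))

{-# OPTIONS --safe #-}
-- Reading a digit string from its top end by Horner's rule
-- σ ↦ βσ + d becomes, in the coordinates x − yβ⁻¹, the integer recurrence (x , y) ↦ (d + Ax − y , x);
-- two finite strings have the same value iff their runs end in the same state.
--
-- Fewer than A digits: give a parallel algorithm the single digit c = M + 1 (or m − 1) at position 0.
-- Output minus input has value 0, yet all its digits satisfy |d| ≤ A − 2 except one nonzero digit with
-- |d| ≤ A − 1. Under the recurrence such a string drives |x| away from 0 for good, a contradiction.
--
-- A digits: as β⁻¹ − A + β = 0, a carry (−A on a digit, +1 on both neighbours) preserves the value.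
-- Sums of two digits fill an interval of width 2A − 2; one round of carries, each decided by a window
-- of 5 digits, brings them into an interval of width A, and a second round into [m, M]. Both carry
-- rules are checked by enumerating all windows of 7 digit classes.
module Submission where

open import Data.Bool.Base using (Bool; true; false; T; not; _∧_; _∨_)
open import Data.Bool.ListAction using (all)
open import Data.Empty using (⊥; ⊥-elim)
open import Data.Fin.Base using (Fin; toℕ)
open import Data.Fin.Properties using (toℕ-fromℕ<)
open import Data.Integer.Base
  using (ℤ; +_; -[1+_]; _+_; _*_; _-_; -_; ∣_∣; _≤_; _<_; +≤+; -≤-; -≤+; +<+; -<+)
open import Data.Integer.Properties
  using (+-assoc; +-comm; +-identityˡ; +-identityʳ; +-inverseʳ; *-identityʳ; *-zeroʳ;
         neg-involutive; neg-distrib-+; pos-*; m-n≡m⊖n; [1+m]⊖[1+n]≡m⊖n;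
         ∣i+j∣≤∣i∣+∣j∣; ∣i-j∣≤∣i∣+∣j∣; 0≤i⇒+∣i∣≡i;
         ≤-refl; ≤-reflexive; ≤-trans; _≤?_; ≰⇒>; <⇒≤; <⇒≢; <-irrefl; <-trans; <-≤-trans; <-cmp;
         +-mono-≤; i≤j⇒0≤j-i; 0≤i-j⇒j≤i; i<j⇒suc[i]≤j; suc[i]≤j⇒i<j)
open import Data.Integer.Tactic.RingSolver using (solve; solve-∀)
open import Data.List.Base using (List; []; _∷_)
open import Data.List.Membership.Propositional using (_∈_)
open import Data.List.Relation.Unary.Any using (here; there)
open import Data.Nat.Base as ℕ using (ℕ; zero; suc)
open import Data.Nat.DivMod using (_%_; _mod_; m%n<n; m<n⇒m%n≡m)
open import Data.Nat.GeneralisedArithmetic using (fold; fold-+)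
import Data.Nat.Properties as ℕ
open import Data.Product.Base using (_×_; _,_; proj₁; proj₂)
open import Function.Base using (_∘_; _∋_)
open import Relation.Binary.Definitions using (tri<; tri≈; tri>)
open import Relation.Binary.PropositionalEquality
  using (_≡_; _≢_; refl; sym; trans; cong; cong₂; subst; subst₂; module ≡-Reasoning)
open import Relation.Nullary using (¬_; yes; no)

open import Defs

infixl 6 _⊕_ _⊖_
infixr 7 _·_

_⊕_ _⊖_ : ℤ × ℤ → ℤ × ℤ → ℤ × ℤ
(x , y) ⊕ (x' , y') = (x + x' , y + y')
(x , y) ⊖ (x' , y') = (x - x' , y - y')

_·_ : ℤ → ℤ × ℤ → ℤ × ℤ
d · (x , y) = (d * x , d * y)

⊕-assoc : ∀ X Y Z → (X ⊕ Y) ⊕ Z ≡ X ⊕ (Y ⊕ Z)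
⊕-assoc (x , y) (x' , y') (x'' , y'') = cong₂ _,_ (+-assoc x x' x'') (+-assoc y y' y'')

⊕-comm : ∀ X Y → X ⊕ Y ≡ Y ⊕ X
⊕-comm (x , y) (x' , y') = cong₂ _,_ (+-comm x x') (+-comm y y')

⊕-identityˡ : ∀ X → (+ 0 , + 0) ⊕ X ≡ X
⊕-identityˡ (x , y) = cong₂ _,_ (+-identityˡ x) (+-identityˡ y)

⊕-identityʳ : ∀ X → X ⊕ (+ 0 , + 0) ≡ X
⊕-identityʳ (x , y) = cong₂ _,_ (+-identityʳ x) (+-identityʳ y)

-- Linear inequalities are proved by exhibiting j − i as a sum of visibly non-negative terms.

≤-via : ∀ {i j} e → j - i ≡ e → + 0 ≤ e → i ≤ j
≤-via e j-i≡e 0≤e = 0≤i-j⇒j≤i (subst (+ 0 ≤_) (sym j-i≡e) 0≤e)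

<-via : ∀ {i j} e → j - (+ 1 + i) ≡ e → + 0 ≤ e → i < j
<-via e j-1-i≡e 0≤e = suc[i]≤j⇒i<j (≤-via e j-1-i≡e 0≤e)

0≤i⇒0≤j⇒0≤i*j : ∀ {i j} → + 0 ≤ i → + 0 ≤ j → + 0 ≤ i * j
0≤i⇒0≤j⇒0≤i*j {+ m} {+ n} _ _ = subst (+ 0 ≤_) (pos-* m n) (+≤+ ℕ.z≤n)

-- ℤ[β] in coordinates, and Horner's scheme

module ℤ[β] (A : ℤ) where

  -- (x , y) stands for x + yβ, where β² = Aβ − 1.
  one : ℤ × ℤ
  one = (+ 1 , + 0)

  mulβ mulβ⁻¹ : ℤ × ℤ → ℤ × ℤ
  mulβ   (x , y) = (- y , x + A * y)
  mulβ⁻¹ (x , y) = (A * x + y , - x)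

  mulβ-⊕ : ∀ X Y → mulβ (X ⊕ Y) ≡ mulβ X ⊕ mulβ Y
  mulβ-⊕ (x , y) (x' , y') = cong₂ _,_ (neg-distrib-+ y y')
    ((x + x') + A * (y + y') ≡ (x + A * y) + (x' + A * y') ∋ solve (A ∷ x ∷ y ∷ x' ∷ y' ∷ []))

  mulβ-· : ∀ d X → mulβ (d · X) ≡ d · mulβ X
  mulβ-· d (x , y) = cong₂ _,_
    (- (d * y) ≡ d * - y ∋ solve (d ∷ y ∷ []))
    (d * x + A * (d * y) ≡ d * (x + A * y) ∋ solve (A ∷ d ∷ x ∷ y ∷ []))

  mulβ-mulβ⁻¹ : ∀ X → mulβ (mulβ⁻¹ X) ≡ X
  mulβ-mulβ⁻¹ (x , y) = cong₂ _,_ (neg-involutive x)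
    ((A * x + y) + A * - x ≡ y ∋ solve (A ∷ x ∷ y ∷ []))

  mulβ⁻¹-mulβ : ∀ X → mulβ⁻¹ (mulβ X) ≡ X
  mulβ⁻¹-mulβ (x , y) = cong₂ _,_
    (A * - y + (x + A * y) ≡ x ∋ solve (A ∷ x ∷ y ∷ [])) (neg-involutive y)

  mulβ^ mulβ⁻^ : ℕ → ℤ × ℤ → ℤ × ℤ
  mulβ^  n X = fold X mulβ n
  mulβ⁻^ n X = fold X mulβ⁻¹ n

  mulβ^-⊕ : ∀ n X Y → mulβ^ n (X ⊕ Y) ≡ mulβ^ n X ⊕ mulβ^ n Y
  mulβ^-⊕ zero    X Y = refl
  mulβ^-⊕ (suc n) X Y = trans (cong mulβ (mulβ^-⊕ n X Y)) (mulβ-⊕ (mulβ^ n X) (mulβ^ n Y))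

  mulβ^-· : ∀ n d X → mulβ^ n (d · X) ≡ d · mulβ^ n X
  mulβ^-· zero    d X = refl
  mulβ^-· (suc n) d X = trans (cong mulβ (mulβ^-· n d X)) (mulβ-· d (mulβ^ n X))

  mulβ^-mulβ : ∀ n X → mulβ^ n (mulβ X) ≡ mulβ (mulβ^ n X)
  mulβ^-mulβ zero    X = refl
  mulβ^-mulβ (suc n) X = cong mulβ (mulβ^-mulβ n X)

  mulβ^-mulβ⁻^ : ∀ n X → mulβ^ n (mulβ⁻^ n X) ≡ X
  mulβ^-mulβ⁻^ zero    X = refl
  mulβ^-mulβ⁻^ (suc n) X = begin
    mulβ (mulβ^ n (mulβ⁻¹ (mulβ⁻^ n X))) ≡⟨ cong mulβ (mulβ^-mulβ⁻¹ n (mulβ⁻^ n X)) ⟨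
    mulβ (mulβ⁻¹ (mulβ^ n (mulβ⁻^ n X))) ≡⟨ mulβ-mulβ⁻¹ _ ⟩
    mulβ^ n (mulβ⁻^ n X)                 ≡⟨ mulβ^-mulβ⁻^ n X ⟩
    X                                    ∎
    where
    open ≡-Reasoning
    mulβ^-mulβ⁻¹ : ∀ n Y → mulβ⁻¹ (mulβ^ n Y) ≡ mulβ^ n (mulβ⁻¹ Y)
    mulβ^-mulβ⁻¹ n Y = begin
      mulβ⁻¹ (mulβ^ n Y)                   ≡⟨ cong (λ Z → mulβ⁻¹ (mulβ^ n Z)) (mulβ-mulβ⁻¹ Y) ⟨
      mulβ⁻¹ (mulβ^ n (mulβ (mulβ⁻¹ Y)))   ≡⟨ cong mulβ⁻¹ (mulβ^-mulβ n (mulβ⁻¹ Y)) ⟩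
      mulβ⁻¹ (mulβ (mulβ^ n (mulβ⁻¹ Y)))   ≡⟨ mulβ⁻¹-mulβ _ ⟩
      mulβ^ n (mulβ⁻¹ Y)                   ∎

  mulβ^-injective : ∀ n {X Y} → mulβ^ n X ≡ mulβ^ n Y → X ≡ Y
  mulβ^-injective zero    e = e
  mulβ^-injective (suc n) {X} {Y} e = mulβ^-injective n (begin
    mulβ^ n X                   ≡⟨ mulβ⁻¹-mulβ _ ⟨
    mulβ⁻¹ (mulβ (mulβ^ n X))   ≡⟨ cong mulβ⁻¹ e ⟩
    mulβ⁻¹ (mulβ (mulβ^ n Y))   ≡⟨ mulβ⁻¹-mulβ _ ⟩
    mulβ^ n Y                   ∎)
    where open ≡-Reasoning

  digitSum : (ℕ → ℤ) → ℕ → ℤ × ℤ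
  digitSum g zero    = (+ 0 , + 0)
  digitSum g (suc k) = (g 0 , + 0) ⊕ mulβ (digitSum (g ∘ suc) k)

  digitSum-snoc : ∀ k g → digitSum g (suc k) ≡ digitSum g k ⊕ g k · mulβ^ k one
  digitSum-snoc zero g = cong₂ _,_ (first (g 0)) (second (g 0))
    where
    first : ∀ d → d + - + 0 ≡ + 0 + d * + 1
    first d = solve (d ∷ [])
    second : ∀ d → + 0 + (+ 0 + A * + 0) ≡ + 0 + d * + 0
    second d = solve (A ∷ d ∷ [])
  digitSum-snoc (suc k) g = begin
    (g 0 , + 0) ⊕ mulβ (digitSum (g ∘ suc) (suc k))
      ≡⟨ cong (λ S → (g 0 , + 0) ⊕ mulβ S) (digitSum-snoc k (g ∘ suc)) ⟩
    (g 0 , + 0) ⊕ mulβ (digitSum (g ∘ suc) k ⊕ g (suc k) · mulβ^ k one)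
      ≡⟨ cong ((g 0 , + 0) ⊕_) (mulβ-⊕ (digitSum (g ∘ suc) k) _) ⟩
    (g 0 , + 0) ⊕ (mulβ (digitSum (g ∘ suc) k) ⊕ mulβ (g (suc k) · mulβ^ k one))
      ≡⟨ cong (λ X → (g 0 , + 0) ⊕ (mulβ (digitSum (g ∘ suc) k) ⊕ X)) (mulβ-· (g (suc k)) (mulβ^ k one)) ⟩
    (g 0 , + 0) ⊕ (mulβ (digitSum (g ∘ suc) k) ⊕ g (suc k) · mulβ^ (suc k) one)
      ≡⟨ ⊕-assoc (g 0 , + 0) (mulβ (digitSum (g ∘ suc) k)) _ ⟨
    digitSum g (suc k) ⊕ g (suc k) · mulβ^ (suc k) one ∎
    where open ≡-Reasoning

  step : ℤ → ℤ × ℤ → ℤ × ℤ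
  step d (x , y) = (d + A * x - y , x)

  -- Horner's rule σ ↦ βσ + d in the coordinates of ι, reading g (k − 1) first.
  run : (ℕ → ℤ) → ℕ → ℤ × ℤ
  run g zero    = (+ 0 , + 0)
  run g (suc k) = step (g 0) (run (g ∘ suc) k)

  -- The state (x , y) of the scheme stands for x − yβ⁻¹ = (x − Ay) + yβ.
  ι ι⁻¹ : ℤ × ℤ → ℤ × ℤ
  ι   (x , y) = (x - A * y , y)
  ι⁻¹ (x , y) = (x + A * y , y)

  ι-injective : ∀ {s s'} → ι s ≡ ι s' → s ≡ s'
  ι-injective {x , y} {x' , y'} e = begin
    (x , y)            ≡⟨ cong (_, y) (x ≡ x - A * y + A * y ∋ solve (A ∷ x ∷ y ∷ [])) ⟩
    ι⁻¹ (ι (x , y))    ≡⟨ cong ι⁻¹ e ⟩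
    ι⁻¹ (ι (x' , y'))  ≡⟨ cong (_, y') (x' - A * y' + A * y' ≡ x' ∋ solve (A ∷ x' ∷ y' ∷ [])) ⟩
    (x' , y')          ∎
    where open ≡-Reasoning

  ι-step : ∀ d s → ι (step d s) ≡ (d , + 0) ⊕ mulβ (ι s)
  ι-step d (x , y) = cong₂ _,_
    ((d + A * x - y) - A * x ≡ d + - y ∋ solve (A ∷ d ∷ x ∷ y ∷ []))
    (x ≡ + 0 + ((x - A * y) + A * y) ∋ solve (A ∷ x ∷ y ∷ []))

  digitSum-run : ∀ g k → digitSum g k ≡ ι (run g k)
  digitSum-run g zero    = cong (_, + 0) (+ 0 ≡ + 0 - A * + 0 ∋ solve (A ∷ []))
  digitSum-run g (suc k) = trans (cong (λ S → (g 0 , + 0) ⊕ mulβ S) (digitSum-run (g ∘ suc) k))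
                                 (sym (ι-step (g 0) (run (g ∘ suc) k)))

  step-⊖ : ∀ d d' s s' → step (d - d') (s ⊖ s') ≡ step d s ⊖ step d' s'
  step-⊖ d d' (x , y) (x' , y') = cong (_, x - x')
    ((d - d') + A * (x - x') - (y - y') ≡ (d + A * x - y) - (d' + A * x' - y')
      ∋ solve (A ∷ d ∷ d' ∷ x ∷ y ∷ x' ∷ y' ∷ []))

  run-⊖ : ∀ g h k → run (λ i → g i - h i) k ≡ run g k ⊖ run h k
  run-⊖ g h zero    = refl
  run-⊖ g h (suc k) = trans (cong (step (g 0 - h 0)) (run-⊖ (g ∘ suc) (h ∘ suc) k))
                            (step-⊖ (g 0) (h 0) (run (g ∘ suc) k) (run (h ∘ suc) k))

  step-carry : ∀ d c₀ c₁ c₂ s →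
               step (d - A * c₁ + c₀ + c₂) (s ⊕ (c₁ , c₂)) ≡ step d s ⊕ (c₀ , c₁)
  step-carry d c₀ c₁ c₂ (x , y) = cong (_, x + c₁)
    ((d - A * c₁ + c₀ + c₂) + A * (x + c₁) - (y + c₂) ≡ (d + A * x - y) + c₀
      ∋ solve (A ∷ d ∷ c₀ ∷ c₁ ∷ c₂ ∷ x ∷ y ∷ []))

  -- A carry of γ (suc i) out of digit i, received by its neighbours, shifts the state by (γ 0 , γ 1).
  run-carry : ∀ k (g h γ : ℕ → ℤ) → (∀ i → h i ≡ g i - A * γ (suc i) + γ i + γ (suc (suc i))) →
              γ k ≡ + 0 → γ (suc k) ≡ + 0 → run h k ≡ run g k ⊕ (γ 0 , γ 1)
  run-carry zero g h γ _ γ₀ γ₁ =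
    sym (cong₂ _,_ (trans (+-identityˡ (γ 0)) γ₀) (trans (+-identityˡ (γ 1)) γ₁))
  run-carry (suc k) g h γ h≡ γₖ γₖ₊₁ = begin
    step (h 0) (run (h ∘ suc) k)
      ≡⟨ cong₂ step (h≡ 0)
                    (run-carry k (g ∘ suc) (h ∘ suc) (γ ∘ suc) (λ i → h≡ (suc i)) γₖ γₖ₊₁) ⟩
    step (g 0 - A * γ 1 + γ 0 + γ 2) (run (g ∘ suc) k ⊕ (γ 1 , γ 2))
      ≡⟨ step-carry (g 0) (γ 0) (γ 1) (γ 2) (run (g ∘ suc) k) ⟩
    step (g 0) (run (g ∘ suc) k) ⊕ (γ 0 , γ 1) ∎
    where open ≡-Reasoning

VanishesBeyond : ℕ → (ℤ → ℤ) → Set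
VanishesBeyond n f = ∀ j → n ℕ.< ∣ j ∣ → f j ≡ + 0

digits : ℕ → (ℤ → ℤ) → ℕ → ℤ
digits zero    w i       = w (+ i)
digits (suc N) w zero    = w -[1+ N ]
digits (suc N) w (suc i) = digits N w i

width : ℕ → ℕ
width N = suc (N ℕ.+ N)

digits-spec : ∀ N w i → digits N w i ≡ w (+ i - + N)
digits-spec zero    w i       = cong w (sym (+-identityʳ (+ i)))
digits-spec (suc N) w zero    = refl
digits-spec (suc N) w (suc i) = trans (digits-spec N w i) (cong w
  (trans (m-n≡m⊖n i N) (sym (trans (m-n≡m⊖n (suc i) (suc N)) ([1+m]⊖[1+n]≡m⊖n i N)))))

digits-top : ∀ N w k → digits N w (N ℕ.+ k) ≡ w (+ k)
digits-top zero    w k = refl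
digits-top (suc N) w k = digits-top N w k

digits-last : ∀ N w → digits N w (width N) ≡ w (+ suc N)
digits-last N w = subst (λ i → digits N w i ≡ w (+ suc N)) (ℕ.+-suc N N) (digits-top N w (suc N))

module Value (a : ℕ) where

  private
    A : ℤ
    A = + a

  open ℤ[β] A

  zbMul-zbInt : ∀ d X → zbMul a (zbInt a d) X ≡ d · X
  zbMul-zbInt d (x , y) = cong₂ _,_ (first d x y) (second A d x y)
    where
    first : ∀ d x y → d * x - + 0 * y ≡ d * x
    first = solve-∀
    second : ∀ A d x y → d * y + + 0 * x + A * (+ 0 * y) ≡ d * y
    second = solve-∀

  zbMul-β : ∀ X → zbMul a (zbβ a) X ≡ mulβ X
  zbMul-β (x , y) = cong₂ _,_ (first x y) (second A x y)
    where
    first : ∀ x y → + 0 * x - + 1 * y ≡ - y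
    first = solve-∀
    second : ∀ A x y → + 0 * y + + 1 * x + A * (+ 1 * y) ≡ x + A * y
    second = solve-∀

  zbMul-β⁻¹ : ∀ X → zbMul a (zbβinv a) X ≡ mulβ⁻¹ X
  zbMul-β⁻¹ (x , y) = cong₂ _,_ (first A x y) (second A x y)
    where
    first : ∀ A x y → A * x - - + 1 * y ≡ A * x + y
    first = solve-∀
    second : ∀ A x y → A * y + - + 1 * x + A * (- + 1 * y) ≡ - x
    second = solve-∀

  βpow-pos : ∀ n → βpow a (+ n) ≡ mulβ^ n one
  βpow-pos zero    = refl
  βpow-pos (suc n) = trans (zbMul-β (βpow a (+ n))) (cong mulβ (βpow-pos n))

  zbPowℕ-βinv : ∀ n → zbPowℕ a (zbβinv a) n ≡ mulβ⁻^ n one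
  zbPowℕ-βinv zero    = refl
  zbPowℕ-βinv (suc n) = trans (zbMul-β⁻¹ (zbPowℕ a (zbβinv a) n)) (cong mulβ⁻¹ (zbPowℕ-βinv n))

  scaled-power : ∀ n d → mulβ^ n (zbMul a (zbInt a d) (βpow a (+ n))) ≡ d · mulβ^ (n ℕ.+ n) one
  scaled-power n d = begin
    mulβ^ n (zbMul a (zbInt a d) (βpow a (+ n)))
      ≡⟨ cong (mulβ^ n) (trans (zbMul-zbInt d _) (cong (d ·_) (βpow-pos n))) ⟩
    mulβ^ n (d · mulβ^ n one)                     ≡⟨ mulβ^-· n d (mulβ^ n one) ⟩
    d · mulβ^ n (mulβ^ n one)                     ≡⟨ cong (d ·_) (fold-+ one mulβ n) ⟨
    d · mulβ^ (n ℕ.+ n) one                       ∎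
    where open ≡-Reasoning

  scaled-inverse : ∀ n d → mulβ^ (suc n) (zbMul a (zbInt a d) (βpow a -[1+ n ])) ≡ (d , + 0)
  scaled-inverse n d = begin
    mulβ^ (suc n) (zbMul a (zbInt a d) (βpow a -[1+ n ]))
      ≡⟨ cong (mulβ^ (suc n)) (trans (zbMul-zbInt d _) (cong (d ·_) (zbPowℕ-βinv (suc n)))) ⟩
    mulβ^ (suc n) (d · mulβ⁻^ (suc n) one)                 ≡⟨ mulβ^-· (suc n) d (mulβ⁻^ (suc n) one) ⟩
    d · mulβ^ (suc n) (mulβ⁻^ (suc n) one)                 ≡⟨ cong (d ·_) (mulβ^-mulβ⁻^ (suc n) one) ⟩
    d · one                                                ≡⟨ cong₂ _,_ (*-identityʳ d) (*-zeroʳ d) ⟩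
    (d , + 0)                                              ∎
    where open ≡-Reasoning

  digitSum-digits-last : ∀ N w → digitSum (digits N w) (suc (width N)) ≡
                         digitSum (digits N w) (width N) ⊕ w (+ suc N) · mulβ^ (width N) one
  digitSum-digits-last N w = trans (digitSum-snoc (width N) (digits N w))
    (cong (λ d → digitSum (digits N w) (width N) ⊕ d · mulβ^ (width N) one) (digits-last N w))

  value-digitSum : ∀ N w → mulβ^ N (value a N w) ≡ digitSum (digits N w) (width N)
  value-digitSum zero w = begin
    zbMul a (zbInt a (w (+ 0))) one  ≡⟨ zbMul-zbInt (w (+ 0)) one ⟩
    w (+ 0) · one                   ≡⟨ ⊕-identityˡ (w (+ 0) · one) ⟨
    (+ 0 , + 0) ⊕ w (+ 0) · one     ≡⟨ digitSum-snoc 0 (digits 0 w) ⟨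
    digitSum (digits 0 w) 1         ∎
    where open ≡-Reasoning
  value-digitSum (suc N) w = begin
    mulβ^ (suc N) (value a N w ⊕ (term (+ suc N) ⊕ term -[1+ N ]))
      ≡⟨ trans (mulβ^-⊕ (suc N) (value a N w) _)
               (cong (mulβ^ (suc N) (value a N w) ⊕_) (mulβ^-⊕ (suc N) _ _)) ⟩
    mulβ (mulβ^ N (value a N w)) ⊕ (mulβ^ (suc N) (term (+ suc N)) ⊕ mulβ^ (suc N) (term -[1+ N ]))
      ≡⟨ cong₂ _⊕_ (cong mulβ (value-digitSum N w))
                   (cong₂ _⊕_ (scaled-power (suc N) w⁺) (scaled-inverse N w⁻)) ⟩
    mulβ S ⊕ (P ⊕ (w⁻ , + 0))
      ≡⟨ trans (sym (⊕-assoc (mulβ S) P (w⁻ , + 0))) (⊕-comm (mulβ S ⊕ P) (w⁻ , + 0)) ⟩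
    (w⁻ , + 0) ⊕ (mulβ S ⊕ P)
      ≡⟨ cong (λ n → (w⁻ , + 0) ⊕ (mulβ S ⊕ w⁺ · mulβ^ n one)) (cong suc (ℕ.+-suc N N)) ⟩
    (w⁻ , + 0) ⊕ (mulβ S ⊕ w⁺ · mulβ (mulβ^ (width N) one))
      ≡⟨ cong ((w⁻ , + 0) ⊕_) (trans (mulβ-⊕ S _) (cong (mulβ S ⊕_) (mulβ-· w⁺ _))) ⟨
    (w⁻ , + 0) ⊕ mulβ (S ⊕ w⁺ · mulβ^ (width N) one)
      ≡⟨ cong (λ X → (w⁻ , + 0) ⊕ mulβ X) (digitSum-digits-last N w) ⟨
    (w⁻ , + 0) ⊕ mulβ (digitSum (digits N w) (suc (width N)))
      ≡⟨ cong (λ n → (w⁻ , + 0) ⊕ mulβ (digitSum (digits N w) (suc n))) (ℕ.+-suc N N) ⟨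
    digitSum (digits (suc N) w) (width (suc N)) ∎
    where
    open ≡-Reasoning
    term : ℤ → ℤ × ℤ
    term j = zbMul a (zbInt a (w j)) (βpow a j)
    w⁺ w⁻ : ℤ
    w⁺ = w (+ suc N)
    w⁻ = w -[1+ N ]
    S P : ℤ × ℤ
    S = digitSum (digits N w) (width N)
    P = w⁺ · mulβ^ (suc N ℕ.+ suc N) one

  value≡⇒run≡ : ∀ N u v → value a N u ≡ value a N v →
                run (digits N u) (width N) ≡ run (digits N v) (width N)
  value≡⇒run≡ N u v e = ι-injective (begin
    ι (run (digits N u) (width N))   ≡⟨ digitSum-run (digits N u) (width N) ⟨
    digitSum (digits N u) (width N)  ≡⟨ value-digitSum N u ⟨
    mulβ^ N (value a N u)            ≡⟨ cong (mulβ^ N) e ⟩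
    mulβ^ N (value a N v)            ≡⟨ value-digitSum N v ⟩
    digitSum (digits N v) (width N)  ≡⟨ digitSum-run (digits N v) (width N) ⟩
    ι (run (digits N v) (width N))   ∎)
    where open ≡-Reasoning

  run≡⇒value≡ : ∀ N u v → run (digits N u) (width N) ≡ run (digits N v) (width N) →
                value a N u ≡ value a N v
  run≡⇒value≡ N u v e = mulβ^-injective N (begin
    mulβ^ N (value a N u)            ≡⟨ value-digitSum N u ⟩
    digitSum (digits N u) (width N)  ≡⟨ digitSum-run (digits N u) (width N) ⟩
    ι (run (digits N u) (width N))   ≡⟨ cong ι e ⟩
    ι (run (digits N v) (width N))   ≡⟨ digitSum-run (digits N v) (width N) ⟨
    digitSum (digits N v) (width N)  ≡⟨ value-digitSum N v ⟨
    mulβ^ N (value a N v)            ∎)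
    where open ≡-Reasoning

  -- Moving a carry c j from position j to its neighbours j ± 1 preserves the value, as β⁻¹ − A + β = 0.
  carries-preserve-value : ∀ n (u v c : ℤ → ℤ) →
    (∀ j → v j ≡ u j - A * c j + c (j - + 1) + c (j + + 1)) →
    VanishesBeyond n c → VanishesBeyond (suc n) u → VanishesBeyond (suc n) v → SameValue a u v
  carries-preserve-value n u v c v≡ c-vanishes u-vanishes v-vanishes =
    N , u-vanishes , v-vanishes , run≡⇒value≡ N u v (sym (begin
      run (digits N v) (width N)
        ≡⟨ run-carry (width N) (digits N u) (digits N v) γ digit≡ γ-last γ-beyond ⟩
      run (digits N u) (width N) ⊕ (γ 0 , γ 1)
        ≡⟨ cong (run (digits N u) (width N) ⊕_) (cong₂ _,_ γ-first γ-second) ⟩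
      run (digits N u) (width N) ⊕ (+ 0 , + 0)
        ≡⟨ ⊕-identityʳ (run (digits N u) (width N)) ⟩
      run (digits N u) (width N) ∎))
    where
    open ≡-Reasoning
    N = suc n
    γ : ℕ → ℤ
    γ = digits (suc N) c
    predecessor : ∀ I M → I - (+ 1 + M) ≡ (I - M) - + 1
    predecessor = solve-∀
    successor : ∀ I M → (+ 1 + I) - M ≡ (I - M) + + 1
    successor = solve-∀
    digit≡ : ∀ i → digits N v i ≡ digits N u i - A * γ (suc i) + γ i + γ (suc (suc i))
    digit≡ i = begin
      digits N v i
        ≡⟨ trans (digits-spec N v i) (v≡ j) ⟩
      u j - A * c j + c (j - + 1) + c (j + + 1)
        ≡⟨ cong₂ _+_ (cong₂ _+_ (cong₂ _-_ (sym (digits-spec N u i)) (cong (A *_) (sym (digits-spec N c i))))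
                                (sym (trans (digits-spec (suc N) c i) (cong c (predecessor (+ i) (+ N))))))
                     (sym (trans (digits-spec N c (suc i)) (cong c (successor (+ i) (+ N))))) ⟩
      digits N u i - A * γ (suc i) + γ i + γ (suc (suc i)) ∎
      where
      j = + i - + N
    n<2+n : n ℕ.< suc N
    n<2+n = ℕ.<-trans (ℕ.n<1+n n) (ℕ.n<1+n N)
    γ-first : γ 0 ≡ + 0
    γ-first = c-vanishes -[1+ N ] n<2+n
    γ-second : γ 1 ≡ + 0
    γ-second = c-vanishes -[1+ n ] (ℕ.n<1+n n)
    γ-last : γ (width N) ≡ + 0
    γ-last = trans (digits-top N c N) (c-vanishes (+ N) (ℕ.n<1+n n))
    γ-beyond : γ (suc (width N)) ≡ + 0
    γ-beyond = trans (digits-last N c) (c-vanishes (+ suc N) n<2+n)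

-- Lower bound

module NonzeroRuns (A : ℤ) (2≤A : + 2 ≤ A) where

  open ℤ[β] A

  Small : ℤ → Set
  Small d = (+ 2 - A ≤ d) × (d ≤ A - + 2)

  Special : ℤ → Set
  Special d = (+ 1 - A ≤ d) × (d ≤ A - + 1) × (d ≢ + 0)

  data Rising : ℤ × ℤ → Set where
    origin : Rising (+ 0 , + 0)
    up     : ∀ {x y} → + 1 ≤ x → y < x → Rising (x , y)
    down   : ∀ {x y} → x ≤ - + 1 → x < y → Rising (x , y)

  data Away : ℤ × ℤ → Set where
    up   : ∀ {x y} → + 1 ≤ x → y ≤ x → Away (x , y)
    down : ∀ {x y} → x ≤ - + 1 → x ≤ y → Away (x , y)

  Away⇒≢0 : ∀ {s} → Away s → proj₁ s ≢ + 0
  Away⇒≢0 (up (+≤+ ()) _) refl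
  Away⇒≢0 (down () _) refl

  private
    0≤A-2 : + 0 ≤ A - + 2
    0≤A-2 = i≤j⇒0≤j-i 2≤A

    step-from-origin : ∀ d → step d (+ 0 , + 0) ≡ (d , + 0)
    step-from-origin d = cong (_, + 0) (d + A * + 0 - + 0 ≡ d ∋ solve (A ∷ d ∷ []))

  rising-digit : ∀ d → Rising (step d (+ 0 , + 0))
  rising-digit d = subst Rising (sym (step-from-origin d)) (digit d)
    where
    digit : ∀ d → Rising (d , + 0)
    digit (+ zero)  = origin
    digit (+ suc n) = up (+≤+ (ℕ.s≤s ℕ.z≤n)) (+<+ (ℕ.s≤s ℕ.z≤n))
    digit -[1+ n ]  = down (-≤- ℕ.z≤n) -<+

  away-digit : ∀ {d} → d ≢ + 0 → Away (step d (+ 0 , + 0))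
  away-digit {d} d≢0 = subst Away (sym (step-from-origin d)) (digit d d≢0)
    where
    digit : ∀ d → d ≢ + 0 → Away (d , + 0)
    digit (+ zero)  0≢0 = ⊥-elim (0≢0 refl)
    digit (+ suc n) _   = up (+≤+ (ℕ.s≤s ℕ.z≤n)) (+≤+ ℕ.z≤n)
    digit -[1+ n ]  _   = down (-≤- ℕ.z≤n) -≤+

  -- In each certificate below, one step moves x away from 0 by the slack in the bound on d,
  -- plus (A − 2)(|x| − 1), plus the slack in |y| ≤ |x|.
  step-Rising : ∀ {s d} → Rising s → Small d → Rising (step d s)
  step-Rising {d = d} origin _ = rising-digit d
  step-Rising {x , y} {d} (up 1≤x y<x) (2-A≤d , _) = up (≤-trans 1≤x (<⇒≤ x<x')) x<x'
    where
    x<x' : x < d + A * x - y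
    x<x' = <-via ((d - (+ 2 - A)) + (A - + 2) * (x - + 1) + (x - (+ 1 + y)))
      (solve (A ∷ d ∷ x ∷ y ∷ []))
      (+-mono-≤ (+-mono-≤ (i≤j⇒0≤j-i 2-A≤d) (0≤i⇒0≤j⇒0≤i*j 0≤A-2 (i≤j⇒0≤j-i 1≤x)))
                (i≤j⇒0≤j-i (i<j⇒suc[i]≤j y<x)))
  step-Rising {x , y} {d} (down x≤-1 x<y) (_ , d≤A-2) = down (≤-trans (<⇒≤ x'<x) x≤-1) x'<x
    where
    x'<x : d + A * x - y < x
    x'<x = <-via ((A - + 2 - d) + (A - + 2) * (- + 1 - x) + (y - (+ 1 + x)))
      (solve (A ∷ d ∷ x ∷ y ∷ []))
      (+-mono-≤ (+-mono-≤ (i≤j⇒0≤j-i d≤A-2) (0≤i⇒0≤j⇒0≤i*j 0≤A-2 (i≤j⇒0≤j-i x≤-1)))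
                (i≤j⇒0≤j-i (i<j⇒suc[i]≤j x<y)))

  step-Special : ∀ {s d} → Rising s → Special d → Away (step d s)
  step-Special origin (_ , _ , d≢0) = away-digit d≢0
  step-Special {x , y} {d} (up 1≤x y<x) (1-A≤d , _ , _) = up (≤-trans 1≤x x≤x') x≤x'
    where
    x≤x' : x ≤ d + A * x - y
    x≤x' = ≤-via ((d - (+ 1 - A)) + (A - + 2) * (x - + 1) + (x - (+ 1 + y)))
      (solve (A ∷ d ∷ x ∷ y ∷ []))
      (+-mono-≤ (+-mono-≤ (i≤j⇒0≤j-i 1-A≤d) (0≤i⇒0≤j⇒0≤i*j 0≤A-2 (i≤j⇒0≤j-i 1≤x)))
                (i≤j⇒0≤j-i (i<j⇒suc[i]≤j y<x)))
  step-Special {x , y} {d} (down x≤-1 x<y) (_ , d≤A-1 , _) = down (≤-trans x'≤x x≤-1) x'≤x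
    where
    x'≤x : d + A * x - y ≤ x
    x'≤x = ≤-via ((A - + 1 - d) + (A - + 2) * (- + 1 - x) + (y - (+ 1 + x)))
      (solve (A ∷ d ∷ x ∷ y ∷ []))
      (+-mono-≤ (+-mono-≤ (i≤j⇒0≤j-i d≤A-1) (0≤i⇒0≤j⇒0≤i*j 0≤A-2 (i≤j⇒0≤j-i x≤-1)))
                (i≤j⇒0≤j-i (i<j⇒suc[i]≤j x<y)))

  step-Away : ∀ {s d} → Away s → Small d → Away (step d s)
  step-Away {x , y} {d} (up 1≤x y≤x) (2-A≤d , _) = up (≤-trans 1≤x x≤x') x≤x'
    where
    x≤x' : x ≤ d + A * x - y
    x≤x' = ≤-via ((d - (+ 2 - A)) + (A - + 2) * (x - + 1) + (x - y))
      (solve (A ∷ d ∷ x ∷ y ∷ []))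
      (+-mono-≤ (+-mono-≤ (i≤j⇒0≤j-i 2-A≤d) (0≤i⇒0≤j⇒0≤i*j 0≤A-2 (i≤j⇒0≤j-i 1≤x)))
                (i≤j⇒0≤j-i y≤x))
  step-Away {x , y} {d} (down x≤-1 x≤y) (_ , d≤A-2) = down (≤-trans x'≤x x≤-1) x'≤x
    where
    x'≤x : d + A * x - y ≤ x
    x'≤x = ≤-via ((A - + 2 - d) + (A - + 2) * (- + 1 - x) + (y - x))
      (solve (A ∷ d ∷ x ∷ y ∷ []))
      (+-mono-≤ (+-mono-≤ (i≤j⇒0≤j-i d≤A-2) (0≤i⇒0≤j⇒0≤i*j 0≤A-2 (i≤j⇒0≤j-i x≤-1)))
                (i≤j⇒0≤j-i x≤y))

  Rising-run : ∀ k g → (∀ i → Small (g i)) → Rising (run g k)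
  Rising-run zero    g small = origin
  Rising-run (suc k) g small = step-Rising (Rising-run k (g ∘ suc) (λ i → small (suc i))) (small 0)

  Away-run : ∀ k g L → L ℕ.< k → (∀ i → i ≢ L → Small (g i)) → Special (g L) → Away (run g k)
  Away-run (suc k) g zero    _             small special =
    step-Special (Rising-run k (g ∘ suc) (λ i → small (suc i) (λ ()))) special
  Away-run (suc k) g (suc L) (ℕ.s≤s L<k) small special =
    step-Away (Away-run k (g ∘ suc) L L<k (λ i i≢L → small (suc i) (i≢L ∘ ℕ.suc-injective)) special)
              (small 0 (λ ()))

  module _ {m M : ℤ} (narrow : M - m + + 1 < A) where

    private
      slack : + 0 ≤ A - (+ 1 + (M - m + + 1))
      slack = i≤j⇒0≤j-i (i<j⇒suc[i]≤j narrow)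

      0≤A : + 0 ≤ A - + 0
      0≤A = i≤j⇒0≤j-i (≤-trans (+≤+ ℕ.z≤n) 2≤A)

    Small-alphabet : ∀ {x} → m ≤ + 0 → + 0 ≤ M → m ≤ x → x ≤ M → Small x
    Small-alphabet {x} m≤0 0≤M m≤x x≤M =
      ≤-via ((x - m) + (M - + 0) + (A - (+ 1 + (M - m + + 1)))) (solve (A ∷ m ∷ M ∷ x ∷ []))
            (+-mono-≤ (+-mono-≤ (i≤j⇒0≤j-i m≤x) (i≤j⇒0≤j-i 0≤M)) slack) ,
      ≤-via ((M - x) + (+ 0 - m) + (A - (+ 1 + (M - m + + 1)))) (solve (A ∷ m ∷ M ∷ x ∷ []))
            (+-mono-≤ (+-mono-≤ (i≤j⇒0≤j-i x≤M) (i≤j⇒0≤j-i m≤0)) slack)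

    Special-above : ∀ {x} → m ≤ x → x ≤ M → Special (x - (M + + 1))
    Special-above {x} m≤x x≤M =
      ≤-via ((x - m) + (A - (+ 1 + (M - m + + 1)))) (solve (A ∷ m ∷ M ∷ x ∷ []))
            (+-mono-≤ (i≤j⇒0≤j-i m≤x) slack) ,
      ≤-via ((M - x) + (A - + 0)) (solve (A ∷ M ∷ x ∷ [])) (+-mono-≤ (i≤j⇒0≤j-i x≤M) 0≤A) ,
      <⇒≢ (x - (M + + 1) < + 0 ∋ <-via (M - x) (solve (M ∷ x ∷ [])) (i≤j⇒0≤j-i x≤M))

    Special-below : ∀ {x} → m ≤ x → x ≤ M → Special (x - (m - + 1))
    Special-below {x} m≤x x≤M =
      ≤-via ((x - m) + (A - + 0)) (solve (A ∷ m ∷ x ∷ [])) (+-mono-≤ (i≤j⇒0≤j-i m≤x) 0≤A) ,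
      ≤-via ((M - x) + (A - (+ 1 + (M - m + + 1)))) (solve (A ∷ m ∷ M ∷ x ∷ []))
            (+-mono-≤ (i≤j⇒0≤j-i x≤M) slack) ,
      (<⇒≢ (+ 0 < x - (m - + 1) ∋ <-via (x - m) (solve (m ∷ x ∷ [])) (i≤j⇒0≤j-i m≤x)) ∘ sym)

impulse : ℤ → ℤ → ℤ
impulse c (+ zero) = c
impulse c _        = + 0

impulse-vanishes : ∀ c → VanishesBeyond 0 (impulse c)
impulse-vanishes c (+ suc _) _ = refl
impulse-vanishes c -[1+ _ ]  _ = refl

digits-impulse-centre : ∀ N c → digits N (impulse c) N ≡ c
digits-impulse-centre zero    c = refl
digits-impulse-centre (suc N) c = digits-impulse-centre N c

digits-impulse-elsewhere : ∀ N c i → i ≢ N → digits N (impulse c) i ≡ + 0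
digits-impulse-elsewhere zero    c zero    0≢0 = ⊥-elim (0≢0 refl)
digits-impulse-elsewhere zero    c (suc i) _   = refl
digits-impulse-elsewhere (suc N) c zero    _   = refl
digits-impulse-elsewhere (suc N) c (suc i) i≢N = digits-impulse-elsewhere N c i (i≢N ∘ cong suc)

digits-∈ : ∀ {P : ℤ → Set} N w → (∀ j → P (w j)) → ∀ i → P (digits N w i)
digits-∈ {P} N w w∈ i = subst P (sym (digits-spec N w i)) (w∈ _)

module LowerBound (a : ℕ) (2≤a : 2 ℕ.≤ a) {m M : ℤ} (m≤0 : m ≤ + 0) (0≤M : + 0 ≤ M)
                  (narrow : M - m + + 1 < + a) where

  open Value a
  open ℤ[β] (+ a)
  open NonzeroRuns (+ a) (+≤+ 2≤a)

  impulse∈ : ∀ {c} → SumAlph (Contig m M) c → ∀ j → SumAlph (Contig m M) (impulse c j)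
  impulse∈ c∈ (+ zero)  = c∈
  impulse∈ c∈ (+ suc _) = + 0 , + 0 , (m≤0 , 0≤M) , (m≤0 , 0≤M) , refl
  impulse∈ c∈ -[1+ _ ]  = + 0 , + 0 , (m≤0 , 0≤M) , (m≤0 , 0≤M) , refl

  -- The output for the impulse c, minus the impulse itself, has value 0, yet its digits are Small
  -- except for a Special one at position 0.
  impulse-obstruction : ∀ c → SumAlph (Contig m M) c → (∀ {x} → m ≤ x → x ≤ M → Special (x - c)) →
                        ¬ AllowsParallelAddition a (Contig m M)
  impulse-obstruction c c∈ special (r , t , Φ , Φ∈ , converts)
    with converts (impulse c) (impulse∈ c∈) (0 , impulse-vanishes c)
  ... | N , _ , _ , same =
    Away⇒≢0 (Away-run (width N) δ N (ℕ.s≤s (ℕ.m≤m+n N N)) δ-small δ-special) δ-run₀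
    where
    open ≡-Reasoning
    v : ℤ → ℤ
    v = localMap r t Φ (impulse c)
    v∈ : ∀ j → Contig m M (v j)
    v∈ j = Φ∈ _ (λ i → impulse∈ c∈ _)
    v-digit∈ : ∀ i → Contig m M (digits N v i)
    v-digit∈ = digits-∈ {Contig m M} N v v∈
    δ : ℕ → ℤ
    δ i = digits N v i - digits N (impulse c) i
    δ-small : ∀ i → i ≢ N → Small (δ i)
    δ-small i i≢N = subst Small
      (sym (trans (cong (λ z → digits N v i - z) (digits-impulse-elsewhere N c i i≢N)) (+-identityʳ _)))
      (Small-alphabet narrow m≤0 0≤M (proj₁ (v-digit∈ i)) (proj₂ (v-digit∈ i)))
    δ-special : Special (δ N)
    δ-special = subst (λ z → Special (digits N v N - z)) (sym (digits-impulse-centre N c))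
      (special (proj₁ (v-digit∈ N)) (proj₂ (v-digit∈ N)))
    δ-run₀ : proj₁ (run δ (width N)) ≡ + 0
    δ-run₀ = begin
      proj₁ (run δ (width N))
        ≡⟨ cong proj₁ (run-⊖ (digits N v) (digits N (impulse c)) (width N)) ⟩
      proj₁ (run (digits N v) (width N) ⊖ run (digits N (impulse c)) (width N))
        ≡⟨ cong (λ s → proj₁ (run (digits N v) (width N) ⊖ s)) (value≡⇒run≡ N (impulse c) v same) ⟩
      proj₁ (run (digits N v) (width N)) - proj₁ (run (digits N v) (width N))
        ≡⟨ +-inverseʳ (proj₁ (run (digits N v) (width N))) ⟩
      + 0 ∎

  no-parallel-addition : m < M → ¬ AllowsParallelAddition a (Contig m M)
  no-parallel-addition m<M with + 1 ≤? M
  ... | yes 1≤M = impulse-obstruction (M + + 1)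
        (M , + 1 , (<⇒≤ m<M , ≤-refl) , (≤-trans m≤0 (+≤+ ℕ.z≤n) , 1≤M) , refl)
        (Special-above narrow)
  ... | no 1≰M = impulse-obstruction (m - + 1)
        (m , - + 1 , (≤-refl , <⇒≤ m<M) , (m≤-1 , ≤-trans -≤+ 0≤M) , refl)
        (Special-below narrow)
    where
    m≤-1 : m ≤ - + 1
    m≤-1 = ≤-via ((M - (+ 1 + m)) + (+ 1 - (+ 1 + M))) (solve (m ∷ M ∷ []))
      (+-mono-≤ (i≤j⇒0≤j-i (i<j⇒suc[i]≤j m<M)) (i≤j⇒0≤j-i (i<j⇒suc[i]≤j (≰⇒> 1≰M))))

record Agree (R : ℕ) (f : ℤ → ℤ) (j : ℤ) (g : ℤ → ℤ) (j' : ℤ) : Set where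
  constructor agree
  field
    at : ∀ k → ∣ k ∣ ℕ.≤ R → f (j + k) ≡ g (j' + k)

open Agree

Local : {B : Set} → ℕ → ((ℤ → ℤ) → ℤ → B) → Set
Local R F = ∀ {f j g j'} → Agree R f j g j' → F f j ≡ F g j'

Agree-centre : ∀ {R f j g j'} → Agree R f j g j' → f j ≡ g j'
Agree-centre {f = f} {j} {g} {j'} f≈g =
  trans (cong f (sym (+-identityʳ j))) (trans (at f≈g (+ 0) ℕ.z≤n) (cong g (+-identityʳ j')))

Agree-weaken : ∀ {R R' f j g j'} → R ℕ.≤ R' → Agree R' f j g j' → Agree R f j g j'
Agree-weaken R≤R' f≈g = agree (λ k ∣k∣≤R → at f≈g k (ℕ.≤-trans ∣k∣≤R R≤R'))

Agree-shift : ∀ {R S f j g j'} → Agree (R ℕ.+ S) f j g j' →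
              ∀ e → ∣ e ∣ ℕ.≤ S → Agree R f (j + e) g (j' + e)
Agree-shift {R} {S} {f} {j} {g} {j'} f≈g e ∣e∣≤S = agree λ k ∣k∣≤R → begin
  f (j + e + k)     ≡⟨ cong f (+-assoc j e k) ⟩
  f (j + (e + k))   ≡⟨ at f≈g (e + k) (∣e+k∣≤R+S k ∣k∣≤R) ⟩
  g (j' + (e + k))  ≡⟨ cong g (+-assoc j' e k) ⟨
  g (j' + e + k)    ∎
  where
  open ≡-Reasoning
  ∣e+k∣≤R+S : ∀ k → ∣ k ∣ ℕ.≤ R → ∣ e + k ∣ ℕ.≤ R ℕ.+ S
  ∣e+k∣≤R+S k ∣k∣≤R = ℕ.≤-trans (∣i+j∣≤∣i∣+∣j∣ e k)
                        (ℕ.≤-trans (ℕ.+-mono-≤ ∣e∣≤S ∣k∣≤R) (ℕ.≤-reflexive (ℕ.+-comm S R)))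

Local-∘ : ∀ {R S} {F G : (ℤ → ℤ) → ℤ → ℤ} →
          Local R F → Local S G → Local (R ℕ.+ S) (λ f → G (F f))
Local-∘ F-local G-local f≈g = G-local (agree λ e ∣e∣≤S → F-local (Agree-shift f≈g e ∣e∣≤S))

VanishesBeyond-mono : ∀ {n n' f} → n ℕ.≤ n' → VanishesBeyond n f → VanishesBeyond n' f
VanishesBeyond-mono n≤n' f-vanishes j n'<∣j∣ = f-vanishes j (ℕ.≤-<-trans n≤n' n'<∣j∣)

Local-vanishes : ∀ {R n} {F : (ℤ → ℤ) → ℤ → ℤ} → Local R F →
                 (∀ j → F (λ _ → + 0) j ≡ + 0) →
                 ∀ {f} → VanishesBeyond n f → VanishesBeyond (n ℕ.+ R) (F f)
Local-vanishes {R} {n} F-local F0≡0 {f} f-vanishes j n+R<∣j∣ = trans (F-local (agree f≈0)) (F0≡0 j)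
  where
  f≈0 : ∀ k → ∣ k ∣ ℕ.≤ R → f (j + k) ≡ + 0
  f≈0 k ∣k∣≤R = f-vanishes (j + k) (ℕ.+-cancelʳ-< R n ∣ j + k ∣ (ℕ.<-≤-trans n+R<∣j∣ (begin
    ∣ j ∣                  ≡⟨ cong ∣_∣ (j ≡ (j + k) - k ∋ solve (j ∷ k ∷ [])) ⟩
    ∣ (j + k) - k ∣        ≤⟨ ∣i-j∣≤∣i∣+∣j∣ (j + k) k ⟩
    ∣ j + k ∣ ℕ.+ ∣ k ∣    ≤⟨ ℕ.+-monoʳ-≤ ∣ j + k ∣ ∣k∣≤R ⟩
    ∣ j + k ∣ ℕ.+ R        ∎)))
    where open ℕ.≤-Reasoning

-- Rounds of carries

data Anchor : Set where
  bottom top : Anchor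

offset : Anchor → ℤ → ℤ → ℤ
offset bottom e x = x - e
offset top    e x = e - x

orient : Anchor → ℤ → ℤ
orient bottom z = z
orient top    z = - z

bit : Bool → ℤ
bit true  = + 1
bit false = + 0

-- A carry rule sends a digit of offset y to y − A·b + l + r, where b says whether it carries and
-- l, r whether its neighbours do; admissibility of (class, b, l, r) keeps the result in range.
record CarryRule (A inWidth outWidth : ℤ) : Set₁ where
  field
    Class             : Set
    classify          : ℤ → Class
    rule              : Class → Class → Class → Class → Class → Bool
    admissible        : Class → Bool → Bool → Bool → Bool
    rule-admissible   : ∀ c₋₃ c₋₂ c₋₁ c₀ c₁ c₂ c₃ →
      T (admissible c₀ (rule c₋₂ c₋₁ c₀ c₁ c₂)
                       (rule c₋₃ c₋₂ c₋₁ c₀ c₁) (rule c₋₁ c₀ c₁ c₂ c₃))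
    admissible-bounds : ∀ {y} b l r → Contig (+ 0) inWidth y → T (admissible (classify y) b l r) →
      Contig (+ 0) outWidth (y - A * bit b + (bit l + bit r))
    quiet             : ∀ {y} → y < outWidth →
      let c = classify y in rule c c c c c ≡ false

module Round {A inWidth outWidth : ℤ} (carryRule : CarryRule A inWidth outWidth) (α : Anchor) (e : ℤ) where

  open CarryRule carryRule

  classAt : (ℤ → ℤ) → ℤ → ℤ → Class
  classAt w j k = classify (offset α e (w (j + k)))

  carries : (ℤ → ℤ) → ℤ → Bool
  carries w j = rule (classAt w j (- + 2)) (classAt w j (- + 1)) (classAt w j (+ 0))
                     (classAt w j (+ 1)) (classAt w j (+ 2))

  carry : (ℤ → ℤ) → ℤ → ℤ
  carry w j = orient α (bit (carries w j))

  apply : (ℤ → ℤ) → ℤ → ℤ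
  apply w j = w j - A * carry w j + carry w (j - + 1) + carry w (j + + 1)

  private
    rule-cong : ∀ {c₋₂ c₋₁ c₀ c₁ c₂ c₋₂' c₋₁' c₀' c₁' c₂'} →
      c₋₂ ≡ c₋₂' → c₋₁ ≡ c₋₁' → c₀ ≡ c₀' → c₁ ≡ c₁' → c₂ ≡ c₂' →
      rule c₋₂ c₋₁ c₀ c₁ c₂ ≡ rule c₋₂' c₋₁' c₀' c₁' c₂'
    rule-cong refl refl refl refl refl = refl

    classAt-shift : ∀ w j d k → classAt w (j + d) k ≡ classAt w j (d + k)
    classAt-shift w j d k = cong (λ i → classify (offset α e (w i))) (+-assoc j d k)

    ∣1∣≤2 : 1 ℕ.≤ 2
    ∣1∣≤2 = ℕ.s≤s ℕ.z≤n

  carries-local : Local 2 carries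
  carries-local {w} {j} {w'} {j'} w≈w' =
    rule-cong (near (- + 2) ℕ.≤-refl) (near (- + 1) ∣1∣≤2) (near (+ 0) ℕ.z≤n)
              (near (+ 1) ∣1∣≤2) (near (+ 2) ℕ.≤-refl)
    where
    near : ∀ k → ∣ k ∣ ℕ.≤ 2 → classAt w j k ≡ classAt w' j' k
    near k ∣k∣≤2 = cong (λ x → classify (offset α e x)) (at w≈w' k ∣k∣≤2)

  carry-local : Local 2 carry
  carry-local w≈w' = cong (orient α ∘ bit) (carries-local w≈w')

  apply-local : Local 3 apply
  apply-local w≈w' =
    cong₂ _+_ (cong₂ _+_ (cong₂ _-_ (Agree-centre w≈w')
                                    (cong (A *_) (carry-local (Agree-weaken (ℕ.n≤1+n 2) w≈w'))))
                         (carry-local (Agree-shift w≈w' (- + 1) ℕ.≤-refl)))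
              (carry-local (Agree-shift w≈w' (+ 1) ℕ.≤-refl))

  carry-zero : offset α e (+ 0) < outWidth → ∀ j → carry (λ _ → + 0) j ≡ + 0
  carry-zero 0-low j = trans (cong (orient α ∘ bit) (quiet 0-low)) (orient-0 α)
    where
    orient-0 : ∀ α → orient α (+ 0) ≡ + 0
    orient-0 bottom = refl
    orient-0 top    = refl

  apply-zero : offset α e (+ 0) < outWidth → ∀ j → apply (λ _ → + 0) j ≡ + 0
  apply-zero 0-low j = begin
    + 0 - A * carry 0s j + carry 0s (j - + 1) + carry 0s (j + + 1)
      ≡⟨ cong₂ _+_ (cong₂ _+_ (cong (λ c → + 0 - A * c) (carry-zero 0-low j))
                              (carry-zero 0-low (j - + 1)))
                   (carry-zero 0-low (j + + 1)) ⟩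
    + 0 - A * + 0 + + 0 + + 0
      ≡⟨ solve (A ∷ []) ⟩
    + 0 ∎
    where
    open ≡-Reasoning
    0s : ℤ → ℤ
    0s _ = + 0

  apply-offset : ∀ w j → offset α e (apply w j) ≡
    offset α e (w j) - A * bit (carries w j) + (bit (carries w (j - + 1)) + bit (carries w (j + + 1)))
  apply-offset w j =
    offset-carry α (w j) (bit (carries w j)) (bit (carries w (j - + 1))) (bit (carries w (j + + 1)))
    where
    offset-carry : ∀ α x b l r →
      offset α e (x - A * orient α b + orient α l + orient α r) ≡ offset α e x - A * b + (l + r)
    offset-carry bottom x b l r =
      (x - A * b + l + r) - e ≡ (x - e) - A * b + (l + r) ∋ solve (A ∷ e ∷ x ∷ b ∷ l ∷ r ∷ [])
    offset-carry top    x b l r =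
      e - (x - A * - b + - l + - r) ≡ (e - x) - A * b + (l + r) ∋ solve (A ∷ e ∷ x ∷ b ∷ l ∷ r ∷ [])

  apply-range : ∀ {w} → (∀ i → Contig (+ 0) inWidth (offset α e (w i))) →
                ∀ j → Contig (+ 0) outWidth (offset α e (apply w j))
  apply-range {w} w∈ j = subst (Contig (+ 0) outWidth) (sym (apply-offset w j))
    (admissible-bounds (carries w j) (carries w (j - + 1)) (carries w (j + + 1)) (w∈ j) admissible-at-j)
    where
    c : ℤ → Class
    c = classAt w j
    centre : c (+ 0) ≡ classify (offset α e (w j))
    centre = cong (λ i → classify (offset α e (w i))) (+-identityʳ j)
    left : carries w (j - + 1) ≡ rule (c (- + 3)) (c (- + 2)) (c (- + 1)) (c (+ 0)) (c (+ 1))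
    left = rule-cong (classAt-shift w j (- + 1) (- + 2)) (classAt-shift w j (- + 1) (- + 1))
                     (classAt-shift w j (- + 1) (+ 0))
                     (classAt-shift w j (- + 1) (+ 1)) (classAt-shift w j (- + 1) (+ 2))
    right : carries w (j + + 1) ≡ rule (c (- + 1)) (c (+ 0)) (c (+ 1)) (c (+ 2)) (c (+ 3))
    right = rule-cong (classAt-shift w j (+ 1) (- + 2)) (classAt-shift w j (+ 1) (- + 1))
                      (classAt-shift w j (+ 1) (+ 0))
                      (classAt-shift w j (+ 1) (+ 1)) (classAt-shift w j (+ 1) (+ 2))
    admissible-at-j : T (admissible (classify (offset α e (w j)))
                                    (carries w j) (carries w (j - + 1)) (carries w (j + + 1)))
    admissible-at-j =
      subst (λ c₀ → T (admissible c₀ (carries w j) (carries w (j - + 1)) (carries w (j + + 1)))) centre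
        (subst₂ (λ l r → T (admissible (c (+ 0)) (carries w j) l r)) (sym left) (sym right)
          (rule-admissible (c (- + 3)) (c (- + 2)) (c (- + 1)) (c (+ 0)) (c (+ 1)) (c (+ 2)) (c (+ 3))))

module Exhaustive {C : Set} (elements : List C) (complete : ∀ c → c ∈ elements) where

  all-sound : ∀ {cs : List C} g → T (all g cs) → ∀ {c} → c ∈ cs → T (g c)
  all-sound {c ∷ _} g h (here refl) with g c
  ... | true  = _
  ... | false = ⊥-elim h
  all-sound {c ∷ _} g h (there c∈cs) with g c
  ... | true  = all-sound g h c∈cs
  ... | false = ⊥-elim h

  Pred : ℕ → Set
  Pred zero    = Bool
  Pred (suc n) = C → Pred n

  every : ∀ n → Pred n → Bool
  every zero    b = b
  every (suc n) f = all (λ c → every n (f c)) elements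

  Holds : ∀ n → Pred n → Set
  Holds zero    b = T b
  Holds (suc n) f = ∀ c → Holds n (f c)

  every-sound : ∀ n f → T (every n f) → Holds n f
  every-sound zero    b h   = h
  every-sound (suc n) f h c = every-sound n (f c) (all-sound (λ c → every n (f c)) h (complete c))

bits-range : ∀ l r → Contig (+ 0) (+ 2) (bit l + bit r)
bits-range false false = ≤-refl , +≤+ ℕ.z≤n
bits-range false true  = +≤+ ℕ.z≤n , +≤+ (ℕ.s≤s ℕ.z≤n)
bits-range true  false = +≤+ ℕ.z≤n , +≤+ (ℕ.s≤s ℕ.z≤n)
bits-range true  true  = +≤+ ℕ.z≤n , ≤-refl

bits-∨ : ∀ l r → T (l ∨ r) → + 1 ≤ bit l + bit r
bits-∨ false true  _ = ≤-refl
bits-∨ true  false _ = ≤-refl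
bits-∨ true  true  _ = +≤+ (ℕ.s≤s ℕ.z≤n)

bits-∧ : ∀ l r → T (l ∧ r) → + 2 ≤ bit l + bit r
bits-∧ true true _ = ≤-refl

bits-nand : ∀ l r → T (not (l ∧ r)) → bit l + bit r ≤ + 1
bits-nand false false _ = +≤+ ℕ.z≤n
bits-nand false true  _ = ≤-refl
bits-nand true  false _ = ≤-refl

bits-nor : ∀ l r → T (not (l ∨ r)) → bit l + bit r ≤ + 0
bits-nor false false _ = ≤-refl

-- Offsets y are classified by classify₁ as low (y < A − 1), edge (y = A − 1) or high (y > A − 1),
-- and by classify₂ as low (y < A − 2), edge₋ (y = A − 2), edge (y = A − 1) or high (y > A − 1).
data Class₁ : Set where
  low edge high : Class₁

data Class₂ : Set where
  low edge₋ edge high : Class₂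

classes₁ : List Class₁
classes₁ = low ∷ edge ∷ high ∷ []

classes₂ : List Class₂
classes₂ = low ∷ edge₋ ∷ edge ∷ high ∷ []

complete₁ : ∀ c → c ∈ classes₁
complete₁ low  = here refl
complete₁ edge = there (here refl)
complete₁ high = there (there (here refl))

complete₂ : ∀ c → c ∈ classes₂
complete₂ low   = here refl
complete₂ edge₋ = there (here refl)
complete₂ edge  = there (there (here refl))
complete₂ high  = there (there (there (here refl)))

rule₁ : Class₁ → Class₁ → Class₁ → Class₁ → Class₁ → Bool
rule₁ _    _    high _    _    = true
rule₁ _    high edge _    _    = true
rule₁ _    _    edge high _    = true
rule₁ high edge edge edge high = true
rule₁ _    _    _    _    _    = false

admissible₁ : Class₁ → Bool → Bool → Bool → Bool
admissible₁ low  b     l r = not b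
admissible₁ edge true  l r = l ∨ r
admissible₁ edge false l r = not (l ∧ r)
admissible₁ high b     l r = b

carries₂ : Class₂ → Class₂ → Class₂ → Bool
carries₂ _    high _    = true
carries₂ high edge _    = true
carries₂ edge edge _    = true
carries₂ _    edge high = true
carries₂ _    edge edge = true
carries₂ _    _    _    = false

rule₂ : Class₂ → Class₂ → Class₂ → Class₂ → Class₂ → Bool
rule₂ c₋₂ c₋₁ edge₋ c₁ c₂ = carries₂ c₋₂ c₋₁ edge₋ ∧ carries₂ edge₋ c₁ c₂
rule₂ _   c₋₁ c₀    c₁ _  = carries₂ c₋₁ c₀ c₁

admissible₂ : Class₂ → Bool → Bool → Bool → Bool
admissible₂ low   b     l r = not b
admissible₂ edge₋ true  l r = l ∧ r
admissible₂ edge₋ false l r = not (l ∧ r)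
admissible₂ edge  true  l r = l ∨ r
admissible₂ edge  false l r = not (l ∨ r)
admissible₂ high  b     l r = b

rule₁-admissible : ∀ c₋₃ c₋₂ c₋₁ c₀ c₁ c₂ c₃ →
  T (admissible₁ c₀ (rule₁ c₋₂ c₋₁ c₀ c₁ c₂) (rule₁ c₋₃ c₋₂ c₋₁ c₀ c₁) (rule₁ c₋₁ c₀ c₁ c₂ c₃))
rule₁-admissible = every-sound 7 check _
  where
  open Exhaustive classes₁ complete₁
  check : Pred 7
  check c₋₃ c₋₂ c₋₁ c₀ c₁ c₂ c₃ =
    admissible₁ c₀ (rule₁ c₋₂ c₋₁ c₀ c₁ c₂) (rule₁ c₋₃ c₋₂ c₋₁ c₀ c₁) (rule₁ c₋₁ c₀ c₁ c₂ c₃)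

rule₂-admissible : ∀ c₋₃ c₋₂ c₋₁ c₀ c₁ c₂ c₃ →
  T (admissible₂ c₀ (rule₂ c₋₂ c₋₁ c₀ c₁ c₂) (rule₂ c₋₃ c₋₂ c₋₁ c₀ c₁) (rule₂ c₋₁ c₀ c₁ c₂ c₃))
rule₂-admissible = every-sound 7 check _
  where
  open Exhaustive classes₂ complete₂
  check : Pred 7
  check c₋₃ c₋₂ c₋₁ c₀ c₁ c₂ c₃ =
    admissible₂ c₀ (rule₂ c₋₂ c₋₁ c₀ c₁ c₂) (rule₂ c₋₃ c₋₂ c₋₁ c₀ c₁) (rule₂ c₋₁ c₀ c₁ c₂ c₃)

module Rules (A : ℤ) (3≤A : + 3 ≤ A) where

  private
    0≤A-3 : + 0 ≤ A - + 3
    0≤A-3 = i≤j⇒0≤j-i 3≤A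

  classify₁ : ℤ → Class₁
  classify₁ y with <-cmp y (A - + 1)
  ... | tri< _ _ _ = low
  ... | tri≈ _ _ _ = edge
  ... | tri> _ _ _ = high

  classify₂ : ℤ → Class₂
  classify₂ y with <-cmp y (A - + 2) | <-cmp y (A - + 1)
  ... | tri< _ _ _ | _          = low
  ... | tri≈ _ _ _ | _          = edge₋
  ... | tri> _ _ _ | tri≈ _ _ _ = edge
  ... | tri> _ _ _ | _          = high

  private
    low₁ : ∀ {y s} → + 0 ≤ y → y < A - + 1 → Contig (+ 0) (+ 2) s → Contig (+ 0) A (y - A * + 0 + s)
    low₁ {y} {s} 0≤y y<A-1 (0≤s , s≤2) =
      ≤-via (y + s) (solve (A ∷ y ∷ s ∷ [])) (+-mono-≤ 0≤y 0≤s) ,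
      ≤-via ((A - + 1 - (+ 1 + y)) + (+ 2 - s)) (solve (A ∷ y ∷ s ∷ []))
            (+-mono-≤ (i≤j⇒0≤j-i (i<j⇒suc[i]≤j y<A-1)) (i≤j⇒0≤j-i s≤2))

    edge-carries₁ : ∀ {s} → + 1 ≤ s → s ≤ + 2 → Contig (+ 0) A (A - + 1 - A * + 1 + s)
    edge-carries₁ {s} 1≤s s≤2 =
      ≤-via (s - + 1) (solve (A ∷ s ∷ [])) (i≤j⇒0≤j-i 1≤s) ,
      ≤-via ((A - + 3) + (+ 2 - s) + + 2) (solve (A ∷ s ∷ []))
            (+-mono-≤ (+-mono-≤ 0≤A-3 (i≤j⇒0≤j-i s≤2)) (+≤+ ℕ.z≤n))

    edge-stays₁ : ∀ {s} → + 0 ≤ s → s ≤ + 1 → Contig (+ 0) A (A - + 1 - A * + 0 + s)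
    edge-stays₁ {s} 0≤s s≤1 =
      ≤-via ((A - + 3) + + 2 + s) (solve (A ∷ s ∷ [])) (+-mono-≤ (+-mono-≤ 0≤A-3 (+≤+ ℕ.z≤n)) 0≤s) ,
      ≤-via (+ 1 - s) (solve (A ∷ s ∷ [])) (i≤j⇒0≤j-i s≤1)

    high₁ : ∀ {y s} → A - + 1 < y → y ≤ A + A - + 2 → Contig (+ 0) (+ 2) s →
            Contig (+ 0) A (y - A * + 1 + s)
    high₁ {y} {s} A-1<y y≤2A-2 (0≤s , s≤2) =
      ≤-via ((y - (+ 1 + (A - + 1))) + s) (solve (A ∷ y ∷ s ∷ []))
            (+-mono-≤ (i≤j⇒0≤j-i (i<j⇒suc[i]≤j A-1<y)) 0≤s) ,
      ≤-via ((A + A - + 2 - y) + (+ 2 - s)) (solve (A ∷ y ∷ s ∷ []))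
            (+-mono-≤ (i≤j⇒0≤j-i y≤2A-2) (i≤j⇒0≤j-i s≤2))

  bounds₁ : ∀ {y} b l r → Contig (+ 0) (A + A - + 2) y → T (admissible₁ (classify₁ y) b l r) →
            Contig (+ 0) A (y - A * bit b + (bit l + bit r))
  bounds₁ {y} b l r y∈ adm with <-cmp y (A - + 1)
  bounds₁ false l r (0≤y , _) _   | tri< y<A-1 _ _ =
    low₁ 0≤y y<A-1 (bits-range l r)
  bounds₁ true  l r _         adm | tri≈ _ refl _  =
    edge-carries₁ (bits-∨ l r adm) (proj₂ (bits-range l r))
  bounds₁ false l r _         adm | tri≈ _ refl _  =
    edge-stays₁ (proj₁ (bits-range l r)) (bits-nand l r adm)
  bounds₁ true  l r (_ , y≤W) _   | tri> _ _ A-1<y =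
    high₁ A-1<y y≤W (bits-range l r)

  quiet₁ : ∀ {y} → y < A → let c = classify₁ y in rule₁ c c c c c ≡ false
  quiet₁ {y} y<A with <-cmp y (A - + 1)
  ... | tri< _ _ _ = refl
  ... | tri≈ _ _ _ = refl
  ... | tri> _ _ A-1<y = ⊥-elim (<-irrefl refl (<-≤-trans y<A A≤y))
    where
    A≤y : A ≤ y
    A≤y = ≤-via (y - (+ 1 + (A - + 1))) (solve (A ∷ y ∷ [])) (i≤j⇒0≤j-i (i<j⇒suc[i]≤j A-1<y))

  reduce₁ : CarryRule A (A + A - + 2) A
  reduce₁ = record
    { Class = Class₁ ; classify = classify₁ ; rule = rule₁ ; admissible = admissible₁
    ; rule-admissible = rule₁-admissible ; admissible-bounds = bounds₁ ; quiet = quiet₁ }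

  private
    low₂ : ∀ {y s} → + 0 ≤ y → y < A - + 2 → Contig (+ 0) (+ 2) s →
           Contig (+ 0) (A - + 1) (y - A * + 0 + s)
    low₂ {y} {s} 0≤y y<A-2 (0≤s , s≤2) =
      ≤-via (y + s) (solve (A ∷ y ∷ s ∷ [])) (+-mono-≤ 0≤y 0≤s) ,
      ≤-via ((A - + 2 - (+ 1 + y)) + (+ 2 - s)) (solve (A ∷ y ∷ s ∷ []))
            (+-mono-≤ (i≤j⇒0≤j-i (i<j⇒suc[i]≤j y<A-2)) (i≤j⇒0≤j-i s≤2))

    edge₋-carries : ∀ {s} → + 2 ≤ s → s ≤ + 2 → Contig (+ 0) (A - + 1) (A - + 2 - A * + 1 + s)
    edge₋-carries {s} 2≤s s≤2 =
      ≤-via (s - + 2) (solve (A ∷ s ∷ [])) (i≤j⇒0≤j-i 2≤s) ,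
      ≤-via ((A - + 3) + (+ 2 - s) + + 2) (solve (A ∷ s ∷ []))
            (+-mono-≤ (+-mono-≤ 0≤A-3 (i≤j⇒0≤j-i s≤2)) (+≤+ ℕ.z≤n))

    edge₋-stays : ∀ {s} → + 0 ≤ s → s ≤ + 1 → Contig (+ 0) (A - + 1) (A - + 2 - A * + 0 + s)
    edge₋-stays {s} 0≤s s≤1 =
      ≤-via ((A - + 3) + + 1 + s) (solve (A ∷ s ∷ [])) (+-mono-≤ (+-mono-≤ 0≤A-3 (+≤+ ℕ.z≤n)) 0≤s) ,
      ≤-via (+ 1 - s) (solve (A ∷ s ∷ [])) (i≤j⇒0≤j-i s≤1)

    edge-carries₂ : ∀ {s} → + 1 ≤ s → s ≤ + 2 → Contig (+ 0) (A - + 1) (A - + 1 - A * + 1 + s)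
    edge-carries₂ {s} 1≤s s≤2 =
      ≤-via (s - + 1) (solve (A ∷ s ∷ [])) (i≤j⇒0≤j-i 1≤s) ,
      ≤-via ((A - + 3) + (+ 2 - s) + + 1) (solve (A ∷ s ∷ []))
            (+-mono-≤ (+-mono-≤ 0≤A-3 (i≤j⇒0≤j-i s≤2)) (+≤+ ℕ.z≤n))

    edge-stays₂ : ∀ {s} → + 0 ≤ s → s ≤ + 0 → Contig (+ 0) (A - + 1) (A - + 1 - A * + 0 + s)
    edge-stays₂ {s} 0≤s s≤0 =
      ≤-via ((A - + 3) + + 2 + s) (solve (A ∷ s ∷ [])) (+-mono-≤ (+-mono-≤ 0≤A-3 (+≤+ ℕ.z≤n)) 0≤s) ,
      ≤-via (+ 0 - s) (solve (A ∷ s ∷ [])) (i≤j⇒0≤j-i s≤0)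

    high₂ : ∀ {y s} → A - + 1 < y → y ≤ A + A - + 3 → Contig (+ 0) (+ 2) s →
            Contig (+ 0) (A - + 1) (y - A * + 1 + s)
    high₂ {y} {s} A-1<y y≤2A-3 (0≤s , s≤2) =
      ≤-via ((y - (+ 1 + (A - + 1))) + s) (solve (A ∷ y ∷ s ∷ []))
            (+-mono-≤ (i≤j⇒0≤j-i (i<j⇒suc[i]≤j A-1<y)) 0≤s) ,
      ≤-via ((A + A - + 3 - y) + (+ 2 - s)) (solve (A ∷ y ∷ s ∷ []))
            (+-mono-≤ (i≤j⇒0≤j-i y≤2A-3) (i≤j⇒0≤j-i s≤2))

    no-integer-between : ∀ {y} → A - + 2 < y → y < A - + 1 → ⊥
    no-integer-between {y} A-2<y y<A-1 = <-irrefl refl (<-≤-trans y<A-1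
      (≤-via (y - (+ 1 + (A - + 2))) (solve (A ∷ y ∷ [])) (i≤j⇒0≤j-i (i<j⇒suc[i]≤j A-2<y))))

  bounds₂ : ∀ {y} b l r → Contig (+ 0) (A + A - + 3) y → T (admissible₂ (classify₂ y) b l r) →
            Contig (+ 0) (A - + 1) (y - A * bit b + (bit l + bit r))
  bounds₂ {y} b l r y∈ adm with <-cmp y (A - + 2) | <-cmp y (A - + 1)
  bounds₂ false l r (0≤y , _) _   | tri< y<A-2 _ _ | _ =
    low₂ 0≤y y<A-2 (bits-range l r)
  bounds₂ true  l r _         adm | tri≈ _ refl _  | _ =
    edge₋-carries (bits-∧ l r adm) (proj₂ (bits-range l r))
  bounds₂ false l r _         adm | tri≈ _ refl _  | _ =
    edge₋-stays (proj₁ (bits-range l r)) (bits-nand l r adm)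
  bounds₂ true  l r _         adm | tri> _ _ _     | tri≈ _ refl _ =
    edge-carries₂ (bits-∨ l r adm) (proj₂ (bits-range l r))
  bounds₂ false l r _         adm | tri> _ _ _     | tri≈ _ refl _ =
    edge-stays₂ (proj₁ (bits-range l r)) (bits-nor l r adm)
  bounds₂ b     l r _         _   | tri> _ _ A-2<y | tri< y<A-1 _ _ =
    ⊥-elim (no-integer-between A-2<y y<A-1)
  bounds₂ true  l r (_ , y≤W) _   | tri> _ _ _     | tri> _ _ A-1<y =
    high₂ A-1<y y≤W (bits-range l r)

  quiet₂ : ∀ {y} → y < A - + 1 → let c = classify₂ y in rule₂ c c c c c ≡ false
  quiet₂ {y} y<A-1 with <-cmp y (A - + 2) | <-cmp y (A - + 1)
  ... | tri< _ _ _ | _              = refl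
  ... | tri≈ _ _ _ | _              = refl
  ... | tri> _ _ _ | tri≈ _ y≡A-1 _ = ⊥-elim (<-irrefl y≡A-1 y<A-1)
  ... | tri> _ _ A-2<y | tri< _ _ _ = ⊥-elim (no-integer-between A-2<y y<A-1)
  ... | tri> _ _ _ | tri> _ _ A-1<y = ⊥-elim (<-irrefl refl (<-trans y<A-1 A-1<y))

  reduce₂ : CarryRule A (A + A - + 3) (A - + 1)
  reduce₂ = record
    { Class = Class₂ ; classify = classify₂ ; rule = rule₂ ; admissible = admissible₂
    ; rule-admissible = rule₂-admissible ; admissible-bounds = bounds₂ ; quiet = quiet₂ }

-- Upper bound

record Anchors (A m M : ℤ) : Set where
  field
    α₁ α₂  : Anchor
    e₁ e₂  : ℤ
    0-low₁ : offset α₁ e₁ (+ 0) < A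
    0-low₂ : offset α₂ e₂ (+ 0) < A - + 1
    enter  : ∀ {x} → Contig (m + m) (M + M) x → Contig (+ 0) (A + A - + 2) (offset α₁ e₁ x)
    chain  : ∀ {x} → Contig (+ 0) A (offset α₁ e₁ x) → Contig (+ 0) (A + A - + 3) (offset α₂ e₂ x)
    leave  : ∀ {x} → Contig (+ 0) (A - + 1) (offset α₂ e₂ x) → Contig m M x

module TwoRounds (A : ℤ) (3≤A : + 3 ≤ A) {m M : ℤ} (anchors : Anchors A m M) where

  open Anchors anchors
  open Rules A 3≤A using (reduce₁; reduce₂)
  private
    module R₁ = Round reduce₁ α₁ e₁
    module R₂ = Round reduce₂ α₂ e₂

  add : (ℤ → ℤ) → ℤ → ℤ
  add u = R₂.apply (R₁.apply u)

  carry : (ℤ → ℤ) → ℤ → ℤ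
  carry u j = R₁.carry u j + R₂.carry (R₁.apply u) j

  add-carries : ∀ u j → add u j ≡ u j - A * carry u j + carry u (j - + 1) + carry u (j + + 1)
  add-carries u j =
    regroup (u j) (R₁.carry u j) (R₁.carry u (j - + 1)) (R₁.carry u (j + + 1))
            (R₂.carry (R₁.apply u) j) (R₂.carry (R₁.apply u) (j - + 1)) (R₂.carry (R₁.apply u) (j + + 1))
    where
    regroup : ∀ x c c₋ c₊ d d₋ d₊ →
      (x - A * c + c₋ + c₊) - A * d + d₋ + d₊ ≡ x - A * (c + d) + (c₋ + d₋) + (c₊ + d₊)
    regroup x c c₋ c₊ d d₋ d₊ = solve (A ∷ x ∷ c ∷ c₋ ∷ c₊ ∷ d ∷ d₋ ∷ d₊ ∷ [])

  add-local : Local 6 add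
  add-local = Local-∘ R₁.apply-local R₂.apply-local

  add-range : ∀ {u} → (∀ i → Contig (m + m) (M + M) (u i)) → ∀ j → Contig m M (add u j)
  add-range u∈ j = leave (R₂.apply-range (λ i → chain (R₁.apply-range (λ i → enter (u∈ i)) i)) j)

  add-vanishes : ∀ {n u} → VanishesBeyond n u → VanishesBeyond (suc (n ℕ.+ 5)) (add u)
  add-vanishes {n} u-vanishes j n+6<∣j∣ =
    Local-vanishes R₂.apply-local (R₂.apply-zero 0-low₂)
      (Local-vanishes R₁.apply-local (R₁.apply-zero 0-low₁) u-vanishes) j
      (subst (ℕ._< ∣ j ∣) (trans (sym (ℕ.+-suc n 5)) (sym (ℕ.+-assoc n 3 3))) n+6<∣j∣)

  carry-vanishes : ∀ {n u} → VanishesBeyond n u → VanishesBeyond (n ℕ.+ 5) (carry u)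
  carry-vanishes {n} u-vanishes j n+5<∣j∣ = cong₂ _+_
    (Local-vanishes R₁.carry-local (R₁.carry-zero 0-low₁) u-vanishes j
      (ℕ.≤-<-trans (ℕ.+-monoʳ-≤ n (ℕ.s≤s (ℕ.s≤s ℕ.z≤n))) n+5<∣j∣))
    (Local-vanishes R₂.carry-local (R₂.carry-zero 0-low₂)
      (Local-vanishes R₁.apply-local (R₁.apply-zero 0-low₁) u-vanishes) j
      (subst (ℕ._< ∣ j ∣) (sym (ℕ.+-assoc n 3 2)) n+5<∣j∣))

-- Each round is anchored at an end of its interval close enough to 0 that the digit 0 never carries:
-- for the first round the end nearer to 0, and then for the second the other end unless m = 0 or M = 0.
module Anchoring (A : ℤ) (3≤A : + 3 ≤ A) {m : ℤ} (m≤0 : m ≤ + 0) (0≤M : + 0 ≤ m + A - + 1) where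

  private
    0≤A-3 : + 0 ≤ A - + 3
    0≤A-3 = i≤j⇒0≤j-i 3≤A

    enter-bottom : ∀ {x} → Contig (m + m) ((m + A - + 1) + (m + A - + 1)) x →
                   Contig (+ 0) (A + A - + 2) (x - (m + m))
    enter-bottom {x} (2m≤x , x≤2M) =
      ≤-via (x - (m + m)) (solve (m ∷ x ∷ [])) (i≤j⇒0≤j-i 2m≤x) ,
      ≤-via (((m + A - + 1) + (m + A - + 1)) - x) (solve (A ∷ m ∷ x ∷ [])) (i≤j⇒0≤j-i x≤2M)

    enter-top : ∀ {x} → Contig (m + m) ((m + A - + 1) + (m + A - + 1)) x →
                Contig (+ 0) (A + A - + 2) (((m + A - + 1) + (m + A - + 1)) - x)
    enter-top {x} (2m≤x , x≤2M) =
      ≤-via (((m + A - + 1) + (m + A - + 1)) - x) (solve (A ∷ m ∷ x ∷ [])) (i≤j⇒0≤j-i x≤2M) ,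
      ≤-via (x - (m + m)) (solve (A ∷ m ∷ x ∷ [])) (i≤j⇒0≤j-i 2m≤x)

    leave-bottom : ∀ {x} → Contig (+ 0) (A - + 1) (x - m) → Contig m (m + A - + 1) x
    leave-bottom {x} (0≤y , y≤A-1) =
      ≤-via ((x - m) - + 0) (solve (m ∷ x ∷ [])) (i≤j⇒0≤j-i 0≤y) ,
      ≤-via ((A - + 1) - (x - m)) (solve (A ∷ m ∷ x ∷ [])) (i≤j⇒0≤j-i y≤A-1)

    leave-top : ∀ {x} → Contig (+ 0) (A - + 1) ((m + A - + 1) - x) → Contig m (m + A - + 1) x
    leave-top {x} (0≤y , y≤A-1) =
      ≤-via ((A - + 1) - ((m + A - + 1) - x)) (solve (A ∷ m ∷ x ∷ [])) (i≤j⇒0≤j-i y≤A-1) ,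
      ≤-via (((m + A - + 1) - x) - + 0) (solve (A ∷ m ∷ x ∷ [])) (i≤j⇒0≤j-i 0≤y)

    0-low₁-bottom : + 0 ≤ m + m + A - + 1 → + 0 - (m + m) < A
    0-low₁-bottom 0≤c = <-via (m + m + A - + 1) (solve (A ∷ m ∷ [])) 0≤c

    0-low₁-top : m + m + A - + 1 < + 0 → ((m + A - + 1) + (m + A - + 1)) - + 0 < A
    0-low₁-top c<0 = <-via ((+ 0 - (+ 1 + (m + m + A - + 1))) + + 1) (solve (A ∷ m ∷ []))
      (+-mono-≤ (i≤j⇒0≤j-i (i<j⇒suc[i]≤j c<0)) (+≤+ ℕ.z≤n))

    0-low₂-bottom : + 1 ≤ m + A - + 1 → + 0 - m < A - + 1
    0-low₂-bottom 1≤M = <-via ((m + A - + 1) - + 1) (solve (A ∷ m ∷ [])) (i≤j⇒0≤j-i 1≤M)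

    0-low₂-top : m ≤ - + 1 → (m + A - + 1) - + 0 < A - + 1
    0-low₂-top m≤-1 = <-via (- + 1 - m) (solve (A ∷ m ∷ [])) (i≤j⇒0≤j-i m≤-1)

    bottom→bottom : + 0 ≤ m → ∀ {x} → Contig (+ 0) A (x - (m + m)) → Contig (+ 0) (A + A - + 3) (x - m)
    bottom→bottom 0≤m {x} (0≤y , y≤A) =
      ≤-via ((x - (m + m)) + (m - + 0)) (solve (m ∷ x ∷ [])) (+-mono-≤ 0≤y (i≤j⇒0≤j-i 0≤m)) ,
      ≤-via ((A - (x - (m + m))) + (A - + 3) + (+ 0 - m)) (solve (A ∷ m ∷ x ∷ []))
            (+-mono-≤ (+-mono-≤ (i≤j⇒0≤j-i y≤A) 0≤A-3) (i≤j⇒0≤j-i m≤0))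

    bottom→top : m ≤ - + 1 → + 1 ≤ m + A - + 1 → ∀ {x} → Contig (+ 0) A (x - (m + m)) →
                 Contig (+ 0) (A + A - + 3) ((m + A - + 1) - x)
    bottom→top m≤-1 1≤M {x} (0≤y , y≤A) =
      ≤-via ((A - (x - (m + m))) + (- + 1 - m)) (solve (A ∷ m ∷ x ∷ []))
            (+-mono-≤ (i≤j⇒0≤j-i y≤A) (i≤j⇒0≤j-i m≤-1)) ,
      ≤-via ((x - (m + m)) + ((m + A - + 1) - + 1)) (solve (A ∷ m ∷ x ∷ []))
            (+-mono-≤ 0≤y (i≤j⇒0≤j-i 1≤M))

    top→bottom : m ≤ - + 1 → + 1 ≤ m + A - + 1 → ∀ {x} →
                 Contig (+ 0) A (((m + A - + 1) + (m + A - + 1)) - x) → Contig (+ 0) (A + A - + 3) (x - m)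
    top→bottom m≤-1 1≤M {x} (0≤y , y≤A) =
      ≤-via ((A - (((m + A - + 1) + (m + A - + 1)) - x)) + ((m + A - + 1) - + 1)) (solve (A ∷ m ∷ x ∷ []))
            (+-mono-≤ (i≤j⇒0≤j-i y≤A) (i≤j⇒0≤j-i 1≤M)) ,
      ≤-via ((((m + A - + 1) + (m + A - + 1)) - x) + (- + 1 - m)) (solve (A ∷ m ∷ x ∷ []))
            (+-mono-≤ 0≤y (i≤j⇒0≤j-i m≤-1))

    top→top : m + A - + 1 ≤ + 0 → ∀ {x} → Contig (+ 0) A (((m + A - + 1) + (m + A - + 1)) - x) →
              Contig (+ 0) (A + A - + 3) ((m + A - + 1) - x)
    top→top M≤0 {x} (0≤y , y≤A) =
      ≤-via ((((m + A - + 1) + (m + A - + 1)) - x) + (+ 0 - (m + A - + 1))) (solve (A ∷ m ∷ x ∷ []))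
            (+-mono-≤ 0≤y (i≤j⇒0≤j-i M≤0)) ,
      ≤-via ((A - (((m + A - + 1) + (m + A - + 1)) - x)) + (A - + 3) + ((m + A - + 1) - + 0))
            (solve (A ∷ m ∷ x ∷ []))
            (+-mono-≤ (+-mono-≤ (i≤j⇒0≤j-i y≤A) 0≤A-3) (i≤j⇒0≤j-i 0≤M))

  anchored-bottom-bottom : + 0 ≤ m + m + A - + 1 → + 0 ≤ m → Anchors A m (m + A - + 1)
  anchored-bottom-bottom 0≤c 0≤m = record
    { α₁ = bottom ; e₁ = m + m ; α₂ = bottom ; e₂ = m
    ; 0-low₁ = 0-low₁-bottom 0≤c ; 0-low₂ = 0-low₂-bottom 1≤M
    ; enter = enter-bottom ; chain = λ {x} → bottom→bottom 0≤m {x} ; leave = leave-bottom }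
    where
    1≤M : + 1 ≤ m + A - + 1
    1≤M = ≤-via ((m - + 0) + (A - + 3) + + 1) (solve (A ∷ m ∷ []))
            (+-mono-≤ (+-mono-≤ (i≤j⇒0≤j-i 0≤m) 0≤A-3) (+≤+ ℕ.z≤n))

  anchored-bottom-top : + 0 ≤ m + m + A - + 1 → m < + 0 → Anchors A m (m + A - + 1)
  anchored-bottom-top 0≤c m<0 = record
    { α₁ = bottom ; e₁ = m + m ; α₂ = top ; e₂ = m + A - + 1
    ; 0-low₁ = 0-low₁-bottom 0≤c ; 0-low₂ = 0-low₂-top m≤-1
    ; enter = enter-bottom ; chain = λ {x} → bottom→top m≤-1 1≤M {x} ; leave = leave-top }
    where
    m≤-1 : m ≤ - + 1
    m≤-1 = ≤-via (+ 0 - (+ 1 + m)) (solve (m ∷ [])) (i≤j⇒0≤j-i (i<j⇒suc[i]≤j m<0))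
    1≤M : + 1 ≤ m + A - + 1
    1≤M = ≤-via ((m + m + A - + 1) + (- + 1 - m)) (solve (A ∷ m ∷ []))
            (+-mono-≤ 0≤c (i≤j⇒0≤j-i m≤-1))

  anchored-top-top : m + m + A - + 1 < + 0 → m + A - + 1 ≤ + 0 → Anchors A m (m + A - + 1)
  anchored-top-top c<0 M≤0 = record
    { α₁ = top ; e₁ = (m + A - + 1) + (m + A - + 1) ; α₂ = top ; e₂ = m + A - + 1
    ; 0-low₁ = 0-low₁-top c<0 ; 0-low₂ = 0-low₂-top m≤-1
    ; enter = enter-top ; chain = λ {x} → top→top M≤0 {x} ; leave = leave-top }
    where
    m≤-1 : m ≤ - + 1
    m≤-1 = ≤-via ((+ 0 - (m + A - + 1)) + (A - + 3) + + 1) (solve (A ∷ m ∷ []))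
             (+-mono-≤ (+-mono-≤ (i≤j⇒0≤j-i M≤0) 0≤A-3) (+≤+ ℕ.z≤n))

  anchored-top-bottom : m + m + A - + 1 < + 0 → + 0 < m + A - + 1 → Anchors A m (m + A - + 1)
  anchored-top-bottom c<0 0<M = record
    { α₁ = top ; e₁ = (m + A - + 1) + (m + A - + 1) ; α₂ = bottom ; e₂ = m
    ; 0-low₁ = 0-low₁-top c<0 ; 0-low₂ = 0-low₂-bottom 1≤M
    ; enter = enter-top ; chain = λ {x} → top→bottom m≤-1 1≤M {x} ; leave = leave-bottom }
    where
    1≤M : + 1 ≤ m + A - + 1
    1≤M = i<j⇒suc[i]≤j 0<M
    m≤-1 : m ≤ - + 1
    m≤-1 = ≤-via ((+ 0 - (+ 1 + (m + m + A - + 1))) + ((m + A - + 1) - + 0)) (solve (A ∷ m ∷ []))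
             (+-mono-≤ (i≤j⇒0≤j-i (i<j⇒suc[i]≤j c<0)) (i≤j⇒0≤j-i 0≤M))

  anchors : Anchors A m (m + A - + 1)
  anchors with + 0 ≤? m + m + A - + 1 | <-cmp m (+ 0) | <-cmp (m + A - + 1) (+ 0)
  ... | yes 0≤c | tri≈ _ m≡0 _ | _            = anchored-bottom-bottom 0≤c (≤-reflexive (sym m≡0))
  ... | yes 0≤c | tri< m<0 _ _ | _            = anchored-bottom-top 0≤c m<0
  ... | yes _   | tri> _ _ 0<m | _            = ⊥-elim (<-irrefl refl (<-≤-trans 0<m m≤0))
  ... | no c≮0  | _            | tri≈ _ M≡0 _ = anchored-top-top (≰⇒> c≮0) (≤-reflexive M≡0)
  ... | no c≮0  | _            | tri> _ _ 0<M = anchored-top-bottom (≰⇒> c≮0) 0<M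
  ... | no _    | _            | tri< M<0 _ _ = ⊥-elim (<-irrefl refl (<-≤-trans M<0 0≤M))

-- localMap 6 6 hands Φ the window w = (u (j + 6), …, u (j − 6)) : Fin 13 → ℤ;
-- extend w lays it out again around position 0.
extend : (Fin 13 → ℤ) → ℤ → ℤ
extend w k = w (∣ + 6 - k ∣ mod 13)

extend-window : ∀ u j → Agree 6 (extend (λ i → u (j + + 6 - + toℕ i))) (+ 0) u j
extend-window u j = agree λ k ∣k∣≤6 → begin
  u (j + + 6 - + toℕ (∣ + 6 - (+ 0 + k) ∣ mod 13))
    ≡⟨ cong (λ k → u (j + + 6 - + toℕ (∣ + 6 - k ∣ mod 13))) (+-identityˡ k) ⟩
  u (j + + 6 - + toℕ (∣ + 6 - k ∣ mod 13))
    ≡⟨ cong (λ i → u (j + + 6 - i)) (index k ∣k∣≤6) ⟩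
  u (j + + 6 - (+ 6 - k))
    ≡⟨ cong u (solve (j ∷ k ∷ [])) ⟩
  u (j + k) ∎
  where
  open ≡-Reasoning
  k≤6 : ∀ k → ∣ k ∣ ℕ.≤ 6 → k ≤ + 6
  k≤6 (+ _)     ∣k∣≤6 = +≤+ ∣k∣≤6
  k≤6 -[1+ _ ]  _     = -≤+
  index : ∀ k → ∣ k ∣ ℕ.≤ 6 → + toℕ (∣ + 6 - k ∣ mod 13) ≡ + 6 - k
  index k ∣k∣≤6 = begin
    + toℕ (∣ + 6 - k ∣ mod 13)  ≡⟨ cong +_ (toℕ-fromℕ< (m%n<n ∣ + 6 - k ∣ 13)) ⟩
    + (∣ + 6 - k ∣ % 13)         ≡⟨ cong +_ (m<n⇒m%n≡m (ℕ.s≤s ∣6-k∣≤12)) ⟩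
    + ∣ + 6 - k ∣                ≡⟨ 0≤i⇒+∣i∣≡i (i≤j⇒0≤j-i (k≤6 k ∣k∣≤6)) ⟩
    + 6 - k                     ∎
    where
    ∣6-k∣≤12 : ∣ + 6 - k ∣ ℕ.≤ 12
    ∣6-k∣≤12 = ℕ.≤-trans (∣i-j∣≤∣i∣+∣j∣ (+ 6) k) (ℕ.+-monoʳ-≤ 6 ∣k∣≤6)

module UpperBound (a : ℕ) (3≤a : 3 ℕ.≤ a) where

  private
    A : ℤ
    A = + a

  parallel-addition : ∀ {m M} → Anchors A m M → AllowsParallelAddition a (Contig m M)
  parallel-addition {m} {M} anchors = 6 , 6 , Φ , Φ∈ , converts
    where
    open TwoRounds A (+≤+ 3≤a) anchors
    open Value a using (carries-preserve-value)
    Φ : (Fin 13 → ℤ) → ℤ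
    Φ w = add (extend w) (+ 0)
    Φ∈ : ∀ w → (∀ i → SumAlph (Contig m M) (w i)) → Contig m M (Φ w)
    Φ∈ w w∈ = add-range (λ k → sum∈ (w∈ (∣ + 6 - k ∣ mod 13))) (+ 0)
      where
      sum∈ : ∀ {z} → SumAlph (Contig m M) z → Contig (m + m) (M + M) z
      sum∈ (x , y , (m≤x , x≤M) , (m≤y , y≤M) , refl) = +-mono-≤ m≤x m≤y , +-mono-≤ x≤M y≤M
    converts : ∀ u → (∀ j → SumAlph (Contig m M) (u j)) → FiniteSupport u →
               SameValue a u (localMap 6 6 Φ u)
    converts u _ (n , u-vanishes) =
      carries-preserve-value (n ℕ.+ 5) u (localMap 6 6 Φ u) (carry u)
        (λ j → trans (localMap≡add j) (add-carries u j))
        (carry-vanishes u-vanishes)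
        (VanishesBeyond-mono (ℕ.≤-trans (ℕ.m≤m+n n 5) (ℕ.n≤1+n _)) u-vanishes)
        (λ j n+6<∣j∣ → trans (localMap≡add j) (add-vanishes u-vanishes j n+6<∣j∣))
      where
      localMap≡add : ∀ j → localMap 6 6 Φ u j ≡ add u j
      localMap≡add j = add-local (extend-window u j)

top-digit : ∀ {m M A} → M - m + + 1 ≡ A → M ≡ m + A - + 1
top-digit {m} {M} refl = M ≡ m + (M - m + + 1) - + 1 ∋ solve (m ∷ M ∷ [])

theorem35 : (a : ℕ) → 3 ℕ.≤ a →
    ((m M : ℤ) → m ≤ + 0 → + 0 ≤ M → M - m + + 1 ≡ + a →
      AllowsParallelAddition a (Contig m M))
    ×
    ((m M : ℤ) → m ≤ + 0 → + 0 ≤ M → m < M → M - m + + 1 < + a →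
      ¬ AllowsParallelAddition a (Contig m M))
theorem35 a 3≤a = a-digits , fewer-digits
  where
  a-digits : (m M : ℤ) → m ≤ + 0 → + 0 ≤ M → M - m + + 1 ≡ + a → AllowsParallelAddition a (Contig m M)
  a-digits m M m≤0 0≤M size with top-digit {m} {M} size
  ... | refl = UpperBound.parallel-addition a 3≤a (Anchoring.anchors (+ a) (+≤+ 3≤a) m≤0 0≤M)

  fewer-digits : (m M : ℤ) → m ≤ + 0 → + 0 ≤ M → m < M → M - m + + 1 < + a →
                 ¬ AllowsParallelAddition a (Contig m M)
  fewer-digits m M m≤0 0≤M m<M narrow =
    LowerBound.no-parallel-addition a (ℕ.≤-trans (ℕ.n≤1+n 2) 3≤a) m≤0 0≤M narrow m<M
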